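{- Let $K$ be a polyhedral map on a surface $S$ with $n$ vertices and let $M$ be its dual map, with vertex set $V_M$ and edge set $E_M$. Let $C$ be a noncontractible separating Hamiltonian cycle in $EG(K)$ and let $G=(V,E)$ be its dual graph in $M$. Then the graph $(V_M,E_M\setminus E)$ has two connected components, neither of which is a proper tree.
   Context: A map on a surface is an embedding of a finite simple graph in a connected closed surface such that the closure of each complementary component is a $p$-gonal 2-disc ($p\ge3$), the faces; it is polyhedral if any two faces meet in the empty set, a vertex or an edge. $EG(\cdot)$ is the edge graph. The dual map $M$ of $K$ has one vertex per face of $K$ and, for each edge $e$ of $K$, an edge (dual of $e$) joining the vertices of the two faces containing $e$. The dual graph of a cycle $C$ of $K$ is the subgraph $G=(V,E)$ of $EG(M)$ where $E$ is the set of edges dual to edges of $C$ and $V$ the set of their endpoints. A cycle is contractible if null-homotopic in $S$, separating if its complement in $S$ is disconnected, and noncontractible separating if separating but not contractible. A tree $T$ in $EG(M)$ with vertex set $\{v_1,\dots,v_k\}$ is a proper tree if: (1) $\sum_{i=1}^k\deg(v_i)=n+2(k-1)$, degrees taken in $EG(M)$; (2) whenever two vertices $u_1,u_2$ of $T$ lie on a face $F$ of $M$, a path joining them in the boundary of $F$ is a subtree of $T$; (3) any path in $T$ lying in a face $F$ of $M$ has length at most $q-2$, where $q$ is the length of the boundary of $F$. -}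

module Defs where

-- Combinatorial encoding of maps on closed surfaces.
-- A map K with n vertices (Fin n) and f faces (Fin f) is given by
-- F : Fin f → List (Fin n), the cyclic boundary polygon of each face.

open import Data.Nat using (ℕ; _≤_; _+_; _*_; _∸_)
open import Data.Fin using (Fin)
open import Data.List using (List; []; _∷_; _++_; zip; length; reverse)
open import Data.Nat.ListAction using (sum)
open import Data.Empty using (⊥)
open import Data.List.Membership.Propositional using (_∈_; _∉_)
open import Data.List.Relation.Unary.Unique.Propositional using (Unique)
open import Data.List.Relation.Unary.All using (All)
open import Data.List.Relation.Binary.Pointwise using (Pointwise)
open import Data.Product using (Σ; ∃; ∃₂; _×_; _,_)
open import Data.Sum using (_⊎_)
open import Relation.Nullary using (¬_)
open import Relation.Binary.PropositionalEquality using (_≡_; _≢_)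
open import Relation.Binary.Construct.Closure.ReflexiveTransitive using (Star)
open import Relation.Binary.Construct.Closure.Equivalence using (EqClosure)

cyc : {A : Set} → List A → List (A × A)
cyc [] = []
cyc (x ∷ xs) = zip (x ∷ xs) (xs ++ x ∷ [])

Side : {A : Set} → List A → A → A → Set
Side l u v = ((u , v) ∈ cyc l) ⊎ ((v , u) ∈ cyc l)

Card : {A : Set} → (A → Set) → ℕ → Set
Card {A} P c = Σ (List A) λ l → Unique l × (∀ a → a ∈ l → P a) × (∀ a → P a → a ∈ l) × length l ≡ c

data Path {A : Set} (R : A → A → Set) : A → A → List A → Set where
  [] : ∀ {a} → Path R a a (a ∷ [])
  _∷_ : ∀ {a b c ps} → R a b → Path R b c ps → Path R a c (a ∷ ps)

module _ {n f : ℕ} (F : Fin f → List (Fin n)) where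

  EdgeK : Fin n → Fin n → Set
  EdgeK u v = ∃ λ i → Side (F i) u v

  -- edge graph EG(M) of the dual map M: faces sharing an edge
  AdjM : Fin f → Fin f → Set
  AdjM i j = i ≢ j × ∃₂ λ u v → Side (F i) u v × Side (F j) u v

  LinkAdj : Fin n → Fin f → Fin f → Set
  LinkAdj v a b = ∃ λ w → Side (F a) v w × Side (F b) v w

  record PolyhedralMap : Set where
    field
      polygon    : ∀ i → 3 ≤ length (F i) × Unique (F i)
      covered    : ∀ v → ∃ λ i → v ∈ F i
      twoFaces   : ∀ u v → EdgeK u v →
                   ∃₂ λ i j → i ≢ j × Side (F i) u v × Side (F j) u v ×
                     (∀ k → Side (F k) u v → k ≡ i ⊎ k ≡ j)
      diskLink   : ∀ v i j → v ∈ F i → v ∈ F j → Star (LinkAdj v) i j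
      connected  : ∀ u v → Star EdgeK u v
      polyhedral : ∀ i j → i ≢ j →
                   (∀ w → w ∈ F i → w ∉ F j)
                   ⊎ (∃ λ v → ∀ w → w ∈ F i → w ∈ F j → w ≡ v)
                   ⊎ (∃₂ λ u v → Side (F i) u v × Side (F j) u v ×
                        (∀ w → w ∈ F i → w ∈ F j → w ≡ u ⊎ w ≡ v))

  HamiltonianCycle : List (Fin n) → Set
  HamiltonianCycle C = Unique C × length C ≡ n × 3 ≤ length C ×
                       (∀ u v → (u , v) ∈ cyc C → EdgeK u v)

  -- elementary (combinatorial) homotopy moves on closed edge walks
  data Move : List (Fin n) → List (Fin n) → Set where
    spur    : ∀ a b x y → EdgeK x y → Move (a ++ x ∷ b) (a ++ x ∷ y ∷ x ∷ b)
    face    : ∀ a b i p q x → F i ≡ p ++ x ∷ q →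
              Move (a ++ x ∷ b) (a ++ x ∷ q ++ p ++ x ∷ b)
    faceRev : ∀ a b i p q x → F i ≡ p ++ x ∷ q →
              Move (a ++ x ∷ b) (a ++ x ∷ reverse (q ++ p) ++ x ∷ b)

  Homotopic : List (Fin n) → List (Fin n) → Set
  Homotopic = EqClosure Move

  Contractible : List (Fin n) → Set
  Contractible [] = ⊥ -- never used: a Hamiltonian cycle is nonempty
  Contractible (c ∷ cs) = Homotopic (c ∷ cs ++ c ∷ []) (c ∷ [])

  -- faces a,b lie in a common component of S \ C
  SepLink : List (Fin n) → Fin f → Fin f → Set
  SepLink C a b = (∃₂ λ u v → Side (F a) u v × Side (F b) u v × ¬ Side C u v)
                  ⊎ (∃ λ v → v ∉ C × v ∈ F a × v ∈ F b)

  Separating : List (Fin n) → Set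
  Separating C = ∃₂ λ a b → ¬ Star (SepLink C) a b

  -- E = edge set of the dual graph of C (duals of edges of C)
  InE : List (Fin n) → Fin f → Fin f → Set
  InE C i j = i ≢ j × ∃₂ λ u v → Side C u v × Side (F i) u v × Side (F j) u v

  CoAdj : List (Fin n) → Fin f → Fin f → Set
  CoAdj C i j = AdjM i j × ¬ InE C i j

  -- dual edge ab lies on the boundary of the face of M dual to vertex x of K
  BdEdge : Fin n → Fin f → Fin f → Set
  BdEdge x a b = a ≢ b × ∃ λ y → Side (F a) x y × Side (F b) x y

  IsTreeIn : List (Fin f) → (Fin f → Fin f → Set) → Set
  IsTreeIn vs TE =
    Unique vs × vs ≢ [] × (∀ a b → TE a b → AdjM a b) ×
    (∀ a b → a ∈ vs → b ∈ vs → Star (λ x y → x ∈ vs × y ∈ vs × TE x y) a b) ×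
    ¬ (∃ λ cs → Unique cs × 3 ≤ length cs ×
         (∀ x y → (x , y) ∈ cyc cs → x ∈ vs × y ∈ vs × TE x y))

  ProperTree : List (Fin f) → (Fin f → Fin f → Set) → Set
  ProperTree vs TE =
    IsTreeIn vs TE ×
    (Σ (List ℕ) λ ds → Pointwise (λ a d → Card (AdjM a) d) vs ds ×
        sum ds ≡ n + 2 * (length vs ∸ 1)) ×
    (∀ x u₁ u₂ → u₁ ∈ vs → u₂ ∈ vs → x ∈ F u₁ → x ∈ F u₂ →
       ∃ λ ps → Path (λ a b → BdEdge x a b × TE a b) u₁ u₂ ps ×
                Unique ps × All (_∈ vs) ps) ×
    (∀ x a b ps q → Path (λ c d → BdEdge x c d × TE c d) a b ps → Unique ps →
       All (_∈ vs) ps → Card (λ j → x ∈ F j) q → length ps ∸ 1 ≤ q ∸ 2)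

{-# OPTIONS --safe #-}
-- Call two faces linked when they share a side that is not on C. Going around a vertex v of C through
-- the sides at v that are off C leads from each face at one C-side at v to a face at the other C-side
-- at v, so the two faces A and B at one side of C reach every face along C, hence every face, as each
-- face has a vertex on the Hamiltonian cycle C and the faces around a vertex are connected. A and B are
-- not linked, for otherwise all faces would be, contradicting that C separates. If the component of A
-- were a tree, its faces would form a disc bounded by C: cutting off a leaf
-- face moves C across that face by a face move and a spur, down to a single face whose boundary is C,
-- so C would be contractible.
module Submission where

open import Defs
import Algebra.Solver.Monoid as MonoidSolver
open import Data.Empty using (⊥; ⊥-elim)
open import Data.Fin using (Fin)
open import Data.Fin.Properties using (_≟_; injective⇒≤) renaming (any? to anyFin?)
open import Data.List using (List; []; _∷_; _++_; _∷ʳ_; length; lookup; reverse; zip; initLast; _∷ʳ′_)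
open import Data.List.Membership.Propositional using (_∈_; _∉_; find; lose)
import Data.List.Membership.DecPropositional as DecMembership
open import Data.List.Membership.Propositional.Properties using (∈-∃++; ∈-++⁻; ∈-++⁺ˡ; ∈-++⁺ʳ; ∈-lookup)
open import Data.List.Properties using (++-assoc; ++-identityʳ; ∷-injective; ∷ʳ-injectiveʳ; reverse-++; unfold-reverse; reverse-involutive; ++-monoid)
open import Data.List.Relation.Binary.Permutation.Propositional using (_↭_; ↭⇒↭ₛ; prep; ↭-sym; ↭-trans; ↭-refl)
open import Data.List.Relation.Binary.Permutation.Propositional.Properties using (++-comm; ↭-reverse; ↭-length; shift; ∈-resp-↭)
open import Data.List.Relation.Binary.Permutation.Setoid.Properties using (Unique-resp-↭)
open import Data.List.Relation.Unary.All as All using (All; []; _∷_)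
open import Data.List.Relation.Unary.All.Properties using (¬Any⇒All¬) renaming (++⁻ʳ to All-++⁻ʳ)
open import Data.List.Relation.Unary.AllPairs using ([]; _∷_)
open import Data.List.Relation.Unary.Any using (here; there; any?)
open import Data.List.Relation.Unary.Unique.Propositional using (Unique)
open import Data.List.Relation.Unary.Unique.Propositional.Properties using (Unique[x∷xs]⇒x∉xs)
open import Data.Nat using (ℕ; zero; suc; _+_; _≤_; _<_; z≤n; s≤s)
open import Data.Nat.Properties using (≤-refl; ≤-trans; ≤-pred; ≤-reflexive; n≤1+n; +-suc; +-identityʳ; <-irrefl; <-≤-trans)
open import Data.Product using (Σ; ∃; ∃₂; _×_; _,_; proj₁; proj₂)
open import Data.Product.Properties using (≡-dec)
open import Data.Sum using (_⊎_; inj₁; inj₂; swap; [_,_]) renaming (map to ⊎-map)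
open import Function using (_∘_; id)
open import Relation.Binary.Construct.Closure.ReflexiveTransitive using (Star; ε; _◅_; _◅◅_)
import Relation.Binary.Construct.Closure.ReflexiveTransitive as Star
import Relation.Binary.Construct.Closure.Equivalence as EqClosure
open import Relation.Binary.Construct.Closure.Symmetric using (fwd; bwd)
open import Relation.Binary.PropositionalEquality using (_≡_; _≢_; refl; sym; trans; cong; subst; setoid; ≢-sym)
import Relation.Binary.Reasoning.Setoid as SetoidReasoning
open import Relation.Nullary using (¬_; Dec; yes; no)
open import Relation.Nullary.Decidable using (_×-dec_; _⊎-dec_; ¬?)

private variable
  A : Set
  m n f : ℕ
  u v w x y z : A
  l l′ : List A
  a b g h i j k : Fin f

-- Cyclic lists

data Consecutive {A : Set} : List A → A → A → Set where
  here  : ∀ {u v l} → Consecutive (u ∷ v ∷ l) u v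
  there : ∀ {x u v l} → Consecutive l u v → Consecutive (x ∷ l) u v

closedWalk : List A → List A
closedWalk []       = []
closedWalk (c ∷ cs) = c ∷ cs ++ c ∷ []

Linked : List A → A → A → Set
Linked l u v = Consecutive l u v ⊎ Consecutive l v u

Adjacent : List A → A → A → Set
Adjacent l = Linked (closedWalk l)

Consecutive-cast : l ≡ l′ → Consecutive l u v → Consecutive l′ u v
Consecutive-cast refl p = p

Consecutive-++⁺ˡ : ∀ l′ → Consecutive l u v → Consecutive (l ++ l′) u v
Consecutive-++⁺ˡ l′ here      = here
Consecutive-++⁺ˡ l′ (there p) = there (Consecutive-++⁺ˡ l′ p)

Consecutive-++⁺ʳ : ∀ l → Consecutive l′ u v → Consecutive (l ++ l′) u v
Consecutive-++⁺ʳ []      p = p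
Consecutive-++⁺ʳ (x ∷ l) p = there (Consecutive-++⁺ʳ l p)

Consecutive-middle : ∀ X Y → Consecutive (X ++ u ∷ v ∷ Y) u v
Consecutive-middle X Y = Consecutive-++⁺ʳ X here

Consecutive-++⁻ : ∀ X z Y → Consecutive (X ++ z ∷ Y) u v →
                  Consecutive (X ∷ʳ z) u v ⊎ Consecutive (z ∷ Y) u v
Consecutive-++⁻ []            z Y p         = inj₂ p
Consecutive-++⁻ (x ∷ [])      z Y here      = inj₁ here
Consecutive-++⁻ (x ∷ x′ ∷ X)  z Y here      = inj₁ here
Consecutive-++⁻ (x ∷ X)       z Y (there p) = ⊎-map there id (Consecutive-++⁻ X z Y p)

Consecutive-∈ : Consecutive l u v → u ∈ l × v ∈ l
Consecutive-∈ here      = here refl , there (here refl)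
Consecutive-∈ (there p) = there (proj₁ (Consecutive-∈ p)) , there (proj₂ (Consecutive-∈ p))

Consecutive-reverse : Consecutive l u v → Consecutive (reverse l) v u
Consecutive-reverse {l = u ∷ v ∷ l} here =
  Consecutive-cast (sym (reverse-++ (u ∷ v ∷ []) l)) (Consecutive-middle (reverse l) [])
Consecutive-reverse {l = x ∷ l} (there p) =
  Consecutive-cast (sym (unfold-reverse x l)) (Consecutive-++⁺ˡ (x ∷ []) (Consecutive-reverse p))

Consecutive-∷ʳ-∈ : ∀ l → Consecutive (l ∷ʳ w) u v → u ∈ l
Consecutive-∷ʳ-∈ []          (there ())
Consecutive-∷ʳ-∈ (a ∷ [])    here      = here refl
Consecutive-∷ʳ-∈ (a ∷ b ∷ l) here      = here refl
Consecutive-∷ʳ-∈ (a ∷ l)     (there p) = there (Consecutive-∷ʳ-∈ l p)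

Consecutive-into-∷ʳ : ∀ l → y ∉ l → Consecutive (l ∷ʳ y) z y → ∃ λ l′ → l ≡ l′ ∷ʳ z
Consecutive-into-∷ʳ []          y∉ (there ())
Consecutive-into-∷ʳ (a ∷ [])    y∉ here      = [] , refl
Consecutive-into-∷ʳ (a ∷ b ∷ l) y∉ here      = ⊥-elim (y∉ (there (here refl)))
Consecutive-into-∷ʳ (a ∷ l)     y∉ (there p) with Consecutive-into-∷ʳ l (λ q → y∉ (there q)) p
... | l′ , refl = a ∷ l′ , refl

Consecutive-∷ʳ-irrefl : ∀ l → Unique l → w ∉ l → ¬ Consecutive (l ∷ʳ w) x x
Consecutive-∷ʳ-irrefl []          _                   w∉ (there ())
Consecutive-∷ʳ-irrefl (a ∷ [])    _                   w∉ here      = w∉ (here refl)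
Consecutive-∷ʳ-irrefl (a ∷ b ∷ l) ((a≢b ∷ _) ∷ _)     w∉ here      = a≢b refl
Consecutive-∷ʳ-irrefl (a ∷ l)     (_ ∷ u)             w∉ (there p) =
  Consecutive-∷ʳ-irrefl l u (λ m → w∉ (there m)) p

∈-zip⇒Consecutive : ∀ a l b → (u , v) ∈ zip (a ∷ l) (l ∷ʳ b) → Consecutive (a ∷ l ∷ʳ b) u v
∈-zip⇒Consecutive a []      b (here refl) = here
∈-zip⇒Consecutive a []      b (there ())
∈-zip⇒Consecutive a (x ∷ l) b (here refl) = here
∈-zip⇒Consecutive a (x ∷ l) b (there p)   = there (∈-zip⇒Consecutive x l b p)

Consecutive⇒∈-zip : ∀ a l b → Consecutive (a ∷ l ∷ʳ b) u v → (u , v) ∈ zip (a ∷ l) (l ∷ʳ b)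
Consecutive⇒∈-zip a []      b here              = here refl
Consecutive⇒∈-zip a []      b (there (there ()))
Consecutive⇒∈-zip a (x ∷ l) b here              = here refl
Consecutive⇒∈-zip a (x ∷ l) b (there p)         = there (Consecutive⇒∈-zip x l b p)

∈-cyc⇒Consecutive : ∀ l → (u , v) ∈ cyc l → Consecutive (closedWalk l) u v
∈-cyc⇒Consecutive (c ∷ cs) = ∈-zip⇒Consecutive c cs c

Consecutive⇒∈-cyc : ∀ l → Consecutive (closedWalk l) u v → (u , v) ∈ cyc l
Consecutive⇒∈-cyc (c ∷ cs) = Consecutive⇒∈-zip c cs c

Side⇒Adjacent : Side l u v → Adjacent l u v
Side⇒Adjacent {l = l} = ⊎-map (∈-cyc⇒Consecutive l) (∈-cyc⇒Consecutive l)

Adjacent⇒Side : Adjacent l u v → Side l u v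
Adjacent⇒Side {l = l} = ⊎-map (Consecutive⇒∈-cyc l) (Consecutive⇒∈-cyc l)

∈-closedWalk⁻ : ∀ l → x ∈ closedWalk l → x ∈ l
∈-closedWalk⁻ (c ∷ cs) (here e)  = here e
∈-closedWalk⁻ (c ∷ cs) (there m) with ∈-++⁻ cs m
... | inj₁ m′       = there m′
... | inj₂ (here e) = here e

Adjacent-∈ : Adjacent l u v → u ∈ l × v ∈ l
Adjacent-∈ {l = l} (inj₁ p) = ∈-closedWalk⁻ l (proj₁ (Consecutive-∈ p)) , ∈-closedWalk⁻ l (proj₂ (Consecutive-∈ p))
Adjacent-∈ {l = l} (inj₂ p) = ∈-closedWalk⁻ l (proj₂ (Consecutive-∈ p)) , ∈-closedWalk⁻ l (proj₁ (Consecutive-∈ p))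

Side-∈ : Side l u v → u ∈ l × v ∈ l
Side-∈ s = Adjacent-∈ (Side⇒Adjacent s)

Adjacent-irrefl : Unique l → 2 ≤ length l → ¬ Adjacent l x x
Adjacent-irrefl {l = c ∷ []}      _                (s≤s ())
Adjacent-irrefl {l = c ∷ c′ ∷ cs} ((c≢c′ ∷ _) ∷ _) _ (inj₁ here)      = c≢c′ refl
Adjacent-irrefl {l = c ∷ c′ ∷ cs} (c∉ ∷ u)         _ (inj₁ (there p)) =
  Consecutive-∷ʳ-irrefl (c′ ∷ cs) u (Unique[x∷xs]⇒x∉xs (c∉ ∷ u)) p
Adjacent-irrefl {l = c ∷ c′ ∷ cs} ((c≢c′ ∷ _) ∷ _) _ (inj₂ here)      = c≢c′ refl
Adjacent-irrefl {l = c ∷ c′ ∷ cs} (c∉ ∷ u)         _ (inj₂ (there p)) =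
  Consecutive-∷ʳ-irrefl (c′ ∷ cs) u (Unique[x∷xs]⇒x∉xs (c∉ ∷ u)) p

Adjacent-≢ : Unique l → 2 ≤ length l → Adjacent l u v → u ≢ v
Adjacent-≢ u len adj refl = Adjacent-irrefl u len adj

adjacent-head : ∀ M → Unique (y ∷ M) → z ≢ y → Adjacent (y ∷ M) y z →
                (∃ λ M′ → M ≡ z ∷ M′) ⊎ (∃ λ M′ → M ≡ M′ ∷ʳ z)
adjacent-head []      _ z≢y (inj₁ here)               = ⊥-elim (z≢y refl)
adjacent-head []      _ z≢y (inj₁ (there (there ())))
adjacent-head []      _ z≢y (inj₂ here)               = ⊥-elim (z≢y refl)
adjacent-head []      _ z≢y (inj₂ (there (there ())))
adjacent-head (m ∷ M) _ _   (inj₁ here)               = inj₁ (M , refl)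
adjacent-head (m ∷ M) u _   (inj₁ (there p))          =
  ⊥-elim (Unique[x∷xs]⇒x∉xs u (Consecutive-∷ʳ-∈ (m ∷ M) p))
adjacent-head (m ∷ M) _ z≢y (inj₂ here)               = ⊥-elim (z≢y refl)
adjacent-head (m ∷ M) u _   (inj₂ (there p))          =
  inj₂ (Consecutive-into-∷ʳ (m ∷ M) (Unique[x∷xs]⇒x∉xs u) p)

Adjacent-last-head : ∀ (x : A) M l → Adjacent (x ∷ M ∷ʳ l) l x
Adjacent-last-head x M l = inj₁ (Consecutive-cast (cong (x ∷_) (sym (++-assoc M (l ∷ []) (x ∷ [])))) (Consecutive-middle (x ∷ M) []))

Consecutive-∷ʳ-++⁺ : ∀ X z Y → Consecutive (X ∷ʳ z) u v → Consecutive (X ++ z ∷ Y) u v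
Consecutive-∷ʳ-++⁺ X z Y p =
  Consecutive-cast (++-assoc X (z ∷ []) Y) (Consecutive-++⁺ˡ Y p)

closedWalk-++ : ∀ (a : A) X b Y → closedWalk (a ∷ X ++ b ∷ Y) ≡ (a ∷ X) ++ b ∷ Y ∷ʳ a
closedWalk-++ a X b Y = cong (a ∷_) (++-assoc X (b ∷ Y) (a ∷ []))

Consecutive-rotate : ∀ X Y → Consecutive (closedWalk (X ++ Y)) u v → Consecutive (closedWalk (Y ++ X)) u v
Consecutive-rotate []      Y  p = Consecutive-cast (cong closedWalk (sym (++-identityʳ Y))) p
Consecutive-rotate (a ∷ X) [] p = Consecutive-cast (cong closedWalk (++-identityʳ (a ∷ X))) p
Consecutive-rotate (a ∷ X) (b ∷ Y) p
  with Consecutive-++⁻ (a ∷ X) b (Y ∷ʳ a) (Consecutive-cast (closedWalk-++ a X b Y) p)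
... | inj₁ q = Consecutive-cast (sym (closedWalk-++ b Y a X)) (Consecutive-++⁺ʳ (b ∷ Y) q)
... | inj₂ q = Consecutive-cast (sym (closedWalk-++ b Y a X)) (Consecutive-∷ʳ-++⁺ (b ∷ Y) a (X ∷ʳ b) q)

closedWalk-reverse : ∀ (c : A) cs → reverse (closedWalk (c ∷ cs)) ≡ closedWalk (c ∷ reverse cs)
closedWalk-reverse c cs = trans (unfold-reverse c (cs ∷ʳ c)) (cong (_∷ʳ c) (reverse-++ cs (c ∷ [])))

Consecutive-reflect : ∀ c cs → Consecutive (closedWalk (c ∷ cs)) u v → Consecutive (closedWalk (c ∷ reverse cs)) v u
Consecutive-reflect c cs p = Consecutive-cast (closedWalk-reverse c cs) (Consecutive-reverse p)

data CycleStep {A : Set} : List A → List A → Set where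
  rotate  : ∀ X Y → CycleStep (X ++ Y) (Y ++ X)
  reflect : ∀ c cs → CycleStep (c ∷ cs) (c ∷ reverse cs)

infix 4 _≋_
_≋_ : List A → List A → Set
_≋_ = Star CycleStep

CycleStep-sym : CycleStep l l′ → CycleStep l′ l
CycleStep-sym (rotate X Y)   = rotate Y X
CycleStep-sym (reflect c cs) =
  subst (λ W → CycleStep (c ∷ reverse cs) (c ∷ W)) (reverse-involutive cs) (reflect c (reverse cs))

≋-sym : l ≋ l′ → l′ ≋ l
≋-sym = Star.reverse CycleStep-sym

CycleStep-adjacent : CycleStep l l′ → Adjacent l u v → Adjacent l′ u v
CycleStep-adjacent (rotate X Y)   = ⊎-map (Consecutive-rotate X Y) (Consecutive-rotate X Y)
CycleStep-adjacent (reflect c cs) = swap ∘ ⊎-map (Consecutive-reflect c cs) (Consecutive-reflect c cs)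

≋-adjacent : l ≋ l′ → Adjacent l u v → Adjacent l′ u v
≋-adjacent ε        a = a
≋-adjacent (s ◅ ss) a = ≋-adjacent ss (CycleStep-adjacent s a)

≋⇒↭ : l ≋ l′ → l ↭ l′
≋⇒↭ ε                     = ↭-refl
≋⇒↭ (rotate X Y ◅ ss)     = ↭-trans (++-comm X Y) (≋⇒↭ ss)
≋⇒↭ (reflect c cs ◅ ss)   = ↭-trans (prep c (↭-sym (↭-reverse cs))) (≋⇒↭ ss)

≋-unique : l ≋ l′ → Unique l → Unique l′
≋-unique p = Unique-resp-↭ (setoid _) (↭⇒↭ₛ (≋⇒↭ p))

≋-length : l ≋ l′ → length l ≡ length l′
≋-length p = ↭-length (≋⇒↭ p)

≋-rotate-to : v ∈ l → ∃ λ M → l ≋ v ∷ M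
≋-rotate-to {v = v} v∈l with ∈-∃++ v∈l
... | X , Y , refl = Y ++ X , rotate X (v ∷ Y) ◅ ε

≋-orient : Unique l → x ≢ y → Adjacent l x y → ∃ λ rest → l ≋ x ∷ y ∷ rest
≋-orient {x = x} {y = y} u x≢y adj with ≋-rotate-to (proj₁ (Adjacent-∈ adj))
... | M , e with adjacent-head M (≋-unique e u) (≢-sym x≢y) (≋-adjacent e adj)
... | inj₁ (M′ , refl) = M′ , e
... | inj₂ (M′ , refl) =
  reverse M′ , e ◅◅ subst (λ W → CycleStep (x ∷ M′ ∷ʳ y) (x ∷ W)) (reverse-++ M′ (y ∷ [])) (reflect x (M′ ∷ʳ y)) ◅ ε

Unique-∷⁺ : x ∉ l → Unique l → Unique (x ∷ l)
Unique-∷⁺ {l = l} x∉l u = ¬Any⇒All¬ l x∉l ∷ u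

Unique-++⇒disjoint : ∀ X {Y : List A} → Unique (X ++ Y) → x ∈ X → x ∉ Y
Unique-++⇒disjoint (a ∷ X) (a∉ ∷ u) (here refl) x∈Y = Unique[x∷xs]⇒x∉xs (a∉ ∷ u) (∈-++⁺ʳ X x∈Y)
Unique-++⇒disjoint (a ∷ X) (_ ∷ u)  (there x∈X) x∈Y = Unique-++⇒disjoint X u x∈X x∈Y

other-neighbour : Unique l → 3 ≤ length l → Adjacent l v x →
                  ∃ λ y → Adjacent l v y × y ≢ x × (∀ z → Adjacent l v z → z ≡ x ⊎ z ≡ y)
other-neighbour {l = l} {v = v} {x = x} u len adj with ≋-orient u (Adjacent-≢ u (≤-trans (n≤1+n 2) len) adj) adj
... | rest , e with initLast rest
... | [] = ⊥-elim (<-irrefl refl (subst (3 ≤_) (≋-length e) len))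
... | K ∷ʳ′ t = t , ≋-adjacent (≋-sym e) (swap (Adjacent-last-head v (x ∷ K) t)) , t≢x , only
  where
  u′ : Unique (v ∷ x ∷ K ∷ʳ t)
  u′ = ≋-unique e u
  t≢x : t ≢ x
  t≢x refl = Unique-++⇒disjoint (v ∷ x ∷ K) u′ (there (here refl)) (here refl)
  only : ∀ z → Adjacent l v z → z ≡ x ⊎ z ≡ t
  only z adj-z with adjacent-head (x ∷ K ∷ʳ t) u′ (≢-sym (Adjacent-≢ u (≤-trans (n≤1+n 2) len) adj-z)) (≋-adjacent e adj-z)
  ... | inj₁ (M′ , eq) = inj₁ (sym (proj₁ (∷-injective eq)))
  ... | inj₂ (M′ , eq) = inj₂ (sym (∷ʳ-injectiveʳ (x ∷ K) M′ eq))

neighbours-unique : Unique l → 3 ≤ length l → Adjacent l v x → Adjacent l v y → x ≢ y →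
                    Adjacent l v z → z ≡ x ⊎ z ≡ y
neighbours-unique u len adj-x adj-y x≢y adj-z with other-neighbour u len adj-x
... | t , _ , _ , only with only _ adj-y
...   | inj₁ y≡x  = ⊥-elim (x≢y (sym y≡x))
...   | inj₂ refl = only _ adj-z

some-neighbour : 2 ≤ length l → v ∈ l → ∃ λ y → Adjacent l v y
some-neighbour len v∈l with ≋-rotate-to v∈l
... | []    , e = ⊥-elim (<-irrefl (sym (≋-length e)) len)
... | m ∷ _ , e = m , ≋-adjacent (≋-sym e) (inj₁ here)

last-∈-suffix : ∀ X {a Y M} → X ++ a ∷ Y ≡ M ∷ʳ z → z ∈ a ∷ Y
last-∈-suffix []           {M = M} eq = subst (_ ∈_) (sym eq) (∈-++⁺ʳ M (here refl))
last-∈-suffix (x ∷ [])     {M = []} ()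
last-∈-suffix (x ∷ x′ ∷ X) {M = []} ()
last-∈-suffix (x ∷ X)      {M = m ∷ M} eq = last-∈-suffix X (proj₂ (∷-injective eq))

module _ {D : List A} (D-unique : Unique D) where

  private
    snoc-prefix : ∀ (q : A) Q p T → q ∷ Q ++ p ∷ T ≡ q ∷ (Q ∷ʳ p) ++ T
    snoc-prefix q Q p T = cong (q ∷_) (sym (++-assoc Q (p ∷ []) T))

    ≋-extend : ∀ q Q p rest → D ≋ q ∷ Q ++ p ∷ rest → z ∉ q ∷ Q ∷ʳ p → Adjacent D p z →
               ∃ λ rest′ → D ≋ q ∷ Q ++ p ∷ z ∷ rest′
    ≋-extend q Q p rest e z∉ adj
      with adjacent-head (rest ++ q ∷ Q) (≋-unique e′ D-unique) (λ z≡p → z∉ (∈-++⁺ʳ (q ∷ Q) (here z≡p))) (≋-adjacent e′ adj)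
      where
      e′ : D ≋ p ∷ rest ++ q ∷ Q
      e′ = e ◅◅ rotate (q ∷ Q) (p ∷ rest) ◅ ε
    ≋-extend q Q p []         e z∉ adj | inj₁ (_ , eq)   = ⊥-elim (z∉ (here (sym (proj₁ (∷-injective eq)))))
    ≋-extend q Q p (r ∷ rest) e z∉ adj | inj₁ (_ , refl) = rest , e
    ≋-extend q Q p rest       e z∉ adj | inj₂ (_ , eq)   = ⊥-elim (z∉ (∈-++⁺ˡ (last-∈-suffix rest eq)))

    ≋-extend-all : ∀ q Q p S rest → D ≋ q ∷ Q ++ p ∷ rest → Unique (q ∷ Q ++ p ∷ S) →
                (∀ a b → Consecutive (p ∷ S) a b → Adjacent D a b) →
                ∃ λ rest′ → D ≋ q ∷ Q ++ p ∷ S ++ rest′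
    ≋-extend-all q Q p []      rest e _ _   = rest , e
    ≋-extend-all q Q p (z ∷ S) rest e u adj
      with ≋-extend q Q p rest e (λ z∈ → Unique-++⇒disjoint (q ∷ Q ∷ʳ p) (subst Unique (snoc-prefix q Q p (z ∷ S)) u) z∈ (here refl))
                    (adj p z here)
    ... | rest′ , e′ with ≋-extend-all q (Q ∷ʳ p) z S rest′ (subst (D ≋_) (snoc-prefix q Q p (z ∷ rest′)) e′)
                            (subst Unique (snoc-prefix q Q p (z ∷ S)) u) (λ a b c → adj a b (there c))
    ... | rest″ , e″ = rest″ , subst (D ≋_) (sym (snoc-prefix q Q p (z ∷ S ++ rest″))) e″

  ≋-path : ∀ P → Unique P → 2 ≤ length P → (∀ a b → Consecutive P a b → Adjacent D a b) →
           ∃ λ rest → D ≋ P ++ rest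
  ≋-path (q ∷ []) _ (s≤s ())
  ≋-path (q ∷ p ∷ S) u _ adj with ≋-orient D-unique (λ q≡p → Unique[x∷xs]⇒x∉xs u (here q≡p)) (adj q p here)
  ... | rest , e = ≋-extend-all q [] p S rest e u (λ a b c → adj a b (there c))

Unique-++⁻ˡ : ∀ X {Y : List A} → Unique (X ++ Y) → Unique X
Unique-++⁻ˡ []      u        = []
Unique-++⁻ˡ (x ∷ X) (x∉ ∷ u) = Unique-∷⁺ (λ x∈X → Unique[x∷xs]⇒x∉xs (x∉ ∷ u) (∈-++⁺ˡ x∈X)) (Unique-++⁻ˡ X u)

Adjacent-split : ∀ x P y Q → Adjacent (x ∷ P ++ y ∷ Q) u v → Linked (x ∷ P ∷ʳ y) u v ⊎ Linked (y ∷ Q ∷ʳ x) u v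
Adjacent-split x P y Q (inj₁ c) = ⊎-map inj₁ inj₁ (Consecutive-++⁻ (x ∷ P) y (Q ∷ʳ x) (Consecutive-cast (closedWalk-++ x P y Q) c))
Adjacent-split x P y Q (inj₂ c) = ⊎-map inj₂ inj₂ (Consecutive-++⁻ (x ∷ P) y (Q ∷ʳ x) (Consecutive-cast (closedWalk-++ x P y Q) c))

Linked⇒Adjacentˡ : ∀ x P y Q → Linked (x ∷ P ∷ʳ y) u v → Adjacent (x ∷ P ++ y ∷ Q) u v
Linked⇒Adjacentˡ x P y Q = ⊎-map into into
  where
  into : ∀ {a b} → Consecutive (x ∷ P ∷ʳ y) a b → Consecutive (closedWalk (x ∷ P ++ y ∷ Q)) a b
  into c = Consecutive-cast (sym (closedWalk-++ x P y Q)) (Consecutive-∷ʳ-++⁺ (x ∷ P) y (Q ∷ʳ x) c)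

Linked⇒Adjacentʳ : ∀ x P y Q → Linked (y ∷ Q ∷ʳ x) u v → Adjacent (x ∷ P ++ y ∷ Q) u v
Linked⇒Adjacentʳ x P y Q = ⊎-map into into
  where
  into : ∀ {a b} → Consecutive (y ∷ Q ∷ʳ x) a b → Consecutive (closedWalk (x ∷ P ++ y ∷ Q)) a b
  into c = Consecutive-cast (sym (closedWalk-++ x P y Q)) (Consecutive-++⁺ʳ (x ∷ P) c)

private
  closing-side-lost : ∀ (x k : A) K l r rest → Unique (x ∷ (k ∷ K ∷ʳ l) ++ r ∷ rest) →
                      ¬ Adjacent (x ∷ (k ∷ K ∷ʳ l) ++ r ∷ rest) x l
  closing-side-lost x k K l r rest u@(_ ∷ u′) adj
    with adjacent-head ((k ∷ K ∷ʳ l) ++ r ∷ rest) u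
                       (λ l≡x → Unique[x∷xs]⇒x∉xs u (∈-++⁺ˡ (there (∈-++⁺ʳ K (here (sym l≡x)))))) adj
  ... | inj₁ (_ , eq) = Unique[x∷xs]⇒x∉xs u′ (subst (_∈ _) (sym (proj₁ (∷-injective eq))) (∈-++⁺ˡ (∈-++⁺ʳ K (here refl))))
  ... | inj₂ (_ , eq) =
    Unique-++⇒disjoint (x ∷ k ∷ K ∷ʳ l) u (there (there (∈-++⁺ʳ K (here refl)))) (last-∈-suffix (k ∷ K ∷ʳ l) eq)

≋-cycle : ∀ {D P : List A} → Unique D → Unique P → 3 ≤ length P → (∀ a b → Adjacent P a b → Adjacent D a b) → D ≋ P
≋-cycle {D = D} {P = x ∷ q} uD uP len sides
  with ≋-path uD (x ∷ q) uP (≤-trans (n≤1+n 2) len) (λ a b c → sides a b (inj₁ (Consecutive-++⁺ˡ (x ∷ []) c)))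
... | []       , e = subst (D ≋_) (++-identityʳ (x ∷ q)) e
... | r ∷ rest , e with initLast q | len
...   | []            | s≤s ()
...   | [] ∷ʳ′ l      | s≤s (s≤s ())
...   | (k ∷ K) ∷ʳ′ l | _ =
  ⊥-elim (closing-side-lost x k K l r rest (≋-unique e uD) (≋-adjacent e (swap (sides l x (Adjacent-last-head x (k ∷ K) l)))))

SameEdge : A → A → A → A → Set
SameEdge u v x y = (u ≡ x × v ≡ y) ⊎ (u ≡ y × v ≡ x)

SameEdge-sym : SameEdge u v x y → SameEdge x y u v
SameEdge-sym (inj₁ (refl , refl)) = inj₁ (refl , refl)
SameEdge-sym (inj₂ (refl , refl)) = inj₂ (refl , refl)

resp-SameEdge : {P : A → A → Set} → (∀ {a b} → P a b → P b a) → SameEdge u v x y → P x y → P u v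
resp-SameEdge sym-P (inj₁ (refl , refl)) p = p
resp-SameEdge sym-P (inj₂ (refl , refl)) p = sym-P p

same-pair : ∀ {A : Set} {s t p q p′ q′ : A} →
            (p ≡ s ⊎ p ≡ t) × (q ≡ s ⊎ q ≡ t) → (p′ ≡ s ⊎ p′ ≡ t) × (q′ ≡ s ⊎ q′ ≡ t) →
            p ≢ q → p′ ≢ q′ → SameEdge p′ q′ p q
same-pair (inj₁ refl , inj₁ refl) _                         p≢q _     = ⊥-elim (p≢q refl)
same-pair (inj₂ refl , inj₂ refl) _                         p≢q _     = ⊥-elim (p≢q refl)
same-pair _                       (inj₁ refl , inj₁ refl)   _   p′≢q′ = ⊥-elim (p′≢q′ refl)
same-pair _                       (inj₂ refl , inj₂ refl)   _   p′≢q′ = ⊥-elim (p′≢q′ refl)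
same-pair (inj₁ refl , inj₂ refl) (inj₁ refl , inj₂ refl)   _   _     = inj₁ (refl , refl)
same-pair (inj₁ refl , inj₂ refl) (inj₂ refl , inj₁ refl)   _   _     = inj₂ (refl , refl)
same-pair (inj₂ refl , inj₁ refl) (inj₁ refl , inj₂ refl)   _   _     = inj₂ (refl , refl)
same-pair (inj₂ refl , inj₁ refl) (inj₂ refl , inj₁ refl)   _   _     = inj₁ (refl , refl)

Linked-pair : Linked (x ∷ y ∷ []) u v → SameEdge u v x y
Linked-pair (inj₁ here)               = inj₁ (refl , refl)
Linked-pair (inj₁ (there (there ())))
Linked-pair (inj₂ here)               = inj₂ (refl , refl)
Linked-pair (inj₂ (there (there ())))

Linked⇒Adjacent : Linked l u v → Adjacent l u v
Linked⇒Adjacent {l = []}     (inj₁ ())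
Linked⇒Adjacent {l = []}     (inj₂ ())
Linked⇒Adjacent {l = c ∷ cs} = ⊎-map (Consecutive-++⁺ˡ (c ∷ [])) (Consecutive-++⁺ˡ (c ∷ []))

ends-not-linked : ∀ (x : A) P y → Unique (x ∷ P ∷ʳ y) → 3 ≤ length (x ∷ P ∷ʳ y) → ¬ Linked (x ∷ P ∷ʳ y) x y
ends-not-linked x []      y _                 (s≤s (s≤s ()))
ends-not-linked x (p ∷ P) y (_ ∷ u)          _ (inj₁ here)      = Unique[x∷xs]⇒x∉xs u (∈-++⁺ʳ P (here refl))
ends-not-linked x (p ∷ P) y u                _ (inj₁ (there c)) = Unique[x∷xs]⇒x∉xs u (proj₁ (Consecutive-∈ c))
ends-not-linked x P       y u                _ (inj₂ c)         = Unique-++⇒disjoint (x ∷ P) u (Consecutive-∷ʳ-∈ (x ∷ P) c) (here refl)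

Unique-∷-++⁻ : ∀ (a : A) X {Y} → Unique (a ∷ X ++ Y) → Unique (a ∷ Y)
Unique-∷-++⁻ a X (a∉ ∷ u) = All-++⁻ʳ X a∉ ∷ drop X u
  where
  drop : ∀ X {Y} → Unique (X ++ Y) → Unique Y
  drop []      u       = u
  drop (_ ∷ X) (_ ∷ u) = drop X u

↭-remove : x ∈ l → ∃ λ l′ → l ↭ x ∷ l′
↭-remove x∈l with ∈-∃++ x∈l
... | X , Y , refl = X ++ Y , shift _ X Y

Adjacent-exists : 2 ≤ length l → ∃₂ (Adjacent l)
Adjacent-exists {l = _ ∷ []}     (s≤s ())
Adjacent-exists {l = c ∷ c′ ∷ _} _ = c , c′ , inj₁ here

Consecutive-propagate : ∀ {A : Set} {P : A → A → Set} x₀ y₀ l →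
                        (∀ {a b c} → Consecutive (x₀ ∷ y₀ ∷ l) a b → Consecutive (x₀ ∷ y₀ ∷ l) b c → P a b → P b c) →
                        P x₀ y₀ → ∀ {u v} → Consecutive (x₀ ∷ y₀ ∷ l) u v → P u v
Consecutive-propagate x₀ y₀ l       step base here               = base
Consecutive-propagate x₀ y₀ []      step base (there (there ()))
Consecutive-propagate x₀ y₀ (z ∷ l) step base (there p)          =
  Consecutive-propagate y₀ z l (λ p q → step (there p) (there q)) (step here (there here) base) p

Unique-length≤ : {l : List (Fin m)} → Unique l → length l ≤ m
Unique-length≤ {l = l} u = injective⇒≤ (lookup-injective u _ _)
  where
  lookup-injective : {l : List (Fin m)} → Unique l → ∀ i j → lookup l i ≡ lookup l j → i ≡ j
  lookup-injective (x∉ ∷ u) Fin.zero    Fin.zero    _  = refl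
  lookup-injective (x∉ ∷ u) Fin.zero    (Fin.suc j) eq = ⊥-elim (Unique[x∷xs]⇒x∉xs (x∉ ∷ u) (subst (_∈ _) (sym eq) (∈-lookup j)))
  lookup-injective (x∉ ∷ u) (Fin.suc i) Fin.zero    eq = ⊥-elim (Unique[x∷xs]⇒x∉xs (x∉ ∷ u) (subst (_∈ _) eq (∈-lookup i)))
  lookup-injective (x∉ ∷ u) (Fin.suc i) (Fin.suc j) eq = cong Fin.suc (lookup-injective u i j eq)

Side? : ∀ (l : List (Fin n)) u v → Dec (Side l u v)
Side? l u v = ((u , v) ∈? cyc l) ⊎-dec ((v , u) ∈? cyc l)
  where open DecMembership (≡-dec _≟_ _≟_) using (_∈?_)

Unique-length≡⇒∈ : {l : List (Fin m)} → Unique l → length l ≡ m → ∀ v → v ∈ l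
Unique-length≡⇒∈ {m = m} {l = l} u len v with v ∈? l
  where open DecMembership (_≟_ {m}) using (_∈?_)
... | yes v∈l = v∈l
... | no  v∉l = ⊥-elim (<-irrefl refl (subst (_≤ m) (cong suc len) (Unique-length≤ (Unique-∷⁺ v∉l u))))

-- Trees in finite graphs

Within : ∀ {A : Set} → List A → (A → A → Set) → A → A → Set
Within R T x y = x ∈ R × y ∈ R × T x y

HasCycle : ∀ {A : Set} → (A → A → Set) → Set
HasCycle T = ∃ λ cs → Unique cs × 3 ≤ length cs × (∀ x y → (x , y) ∈ cyc cs → T x y)

IsLeaf : ∀ {A : Set} → List A → (A → A → Set) → A → A → Set
IsLeaf R T L L′ = L ∈ R × L′ ∈ R × T L L′ × (∀ h → h ∈ R → T L h → h ≡ L′)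

Star-first : ∀ {A : Set} {T : A → A → Set} {a b} → a ≢ b → Star T a b → ∃ (T a)
Star-first a≢b ε       = ⊥-elim (a≢b refl)
Star-first _   (t ◅ _) = _ , t

module Leaves {m : ℕ} {T : Fin m → Fin m → Set} (T? : ∀ i j → Dec (T i j)) (T-sym : ∀ {i j} → T i j → T j i)
              (T-irrefl : ∀ {i} → ¬ T i i) (R : List (Fin m)) (acyclic : ¬ HasCycle (Within R T)) where

  open DecMembership (_≟_ {m}) using (_∈?_)

  private
    cycle-length : ∀ (a b : Fin m) A z → 3 ≤ length (a ∷ b ∷ A ∷ʳ z)
    cycle-length a b []      z = s≤s (s≤s (s≤s z≤n))
    cycle-length a b (_ ∷ _) z = s≤s (s≤s (s≤s z≤n))

    closing-cycle : ∀ cur prev A z B → Unique (cur ∷ prev ∷ A ++ z ∷ B) → All (_∈ R) (cur ∷ prev ∷ A ++ z ∷ B) →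
                    (∀ x y → Consecutive (cur ∷ prev ∷ A ++ z ∷ B) x y → T x y) → z ∈ R → T cur z → HasCycle (Within R T)
    closing-cycle cur prev A z B u in-R path z∈R cur-z =
      cur ∷ prev ∷ A ∷ʳ z , Unique-++⁻ˡ (cur ∷ prev ∷ A ∷ʳ z) (subst Unique reassoc u) , cycle-length cur prev A z , edge
      where
      reassoc : cur ∷ prev ∷ A ++ z ∷ B ≡ (cur ∷ prev ∷ A ∷ʳ z) ++ B
      reassoc = cong (λ W → cur ∷ prev ∷ W) (sym (++-assoc A (z ∷ []) B))
      edge : ∀ x y → (x , y) ∈ cyc (cur ∷ prev ∷ A ∷ʳ z) → Within R T x y
      edge x y p
        with Consecutive-++⁻ (cur ∷ prev ∷ A) z (cur ∷ [])
               (Consecutive-cast (closedWalk-++ cur (prev ∷ A) z []) (∈-cyc⇒Consecutive (cur ∷ prev ∷ A ∷ʳ z) p))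
      ... | inj₁ c = All.lookup in-R (proj₁ (Consecutive-∈ c′)) , All.lookup in-R (proj₂ (Consecutive-∈ c′)) , path x y c′
        where
        c′ : Consecutive (cur ∷ prev ∷ A ++ z ∷ B) x y
        c′ = Consecutive-∷ʳ-++⁺ (cur ∷ prev ∷ A) z B c
      ... | inj₂ here = z∈R , All.lookup in-R (here refl) , T-sym cur-z
      ... | inj₂ (there (there ()))

    extend : ∀ fuel cur prev rest → m < length (cur ∷ prev ∷ rest) + fuel → Unique (cur ∷ prev ∷ rest) →
             All (_∈ R) (cur ∷ prev ∷ rest) → (∀ x y → Consecutive (cur ∷ prev ∷ rest) x y → T x y) → ∃₂ (IsLeaf R T)
    extend zero cur prev rest bound u _ _ =
      ⊥-elim (<-irrefl refl (<-≤-trans (subst (m <_) (+-identityʳ _) bound) (Unique-length≤ u)))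
    extend (suc fuel) cur prev rest bound u in-R path with any? (λ z → ¬? (z ≟ prev) ×-dec T? cur z) R
    ... | no none = cur , prev , All.lookup in-R (here refl) , All.lookup in-R (there (here refl)) , path cur prev here , only-prev
      where
      only-prev : ∀ h → h ∈ R → T cur h → h ≡ prev
      only-prev h h∈R cur-h with h ≟ prev
      ... | yes h≡prev = h≡prev
      ... | no h≢prev  = ⊥-elim (none (lose h∈R (h≢prev , cur-h)))
    ... | yes some with find some
    ...   | z , z∈R , z≢prev , cur-z with z ∈? (cur ∷ prev ∷ rest)
    ...     | no z∉path = extend fuel z cur (prev ∷ rest) (subst (m <_) (+-suc _ fuel) bound) (Unique-∷⁺ z∉path u) (z∈R ∷ in-R) path′
      where
      path′ : ∀ x y → Consecutive (z ∷ cur ∷ prev ∷ rest) x y → T x y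
      path′ x y here      = T-sym cur-z
      path′ x y (there c) = path x y c
    ...     | yes (here refl)         = ⊥-elim (T-irrefl cur-z)
    ...     | yes (there (here refl)) = ⊥-elim (z≢prev refl)
    ...     | yes (there (there z∈rest)) with ∈-∃++ z∈rest
    ...       | A , B , refl = ⊥-elim (acyclic (closing-cycle cur prev A z B u in-R path z∈R cur-z))

  leaf : ∀ {a b} → a ∈ R → b ∈ R → T a b → ∃₂ (IsLeaf R T)
  leaf {a} {b} a∈R b∈R a-b =
    extend m b a [] (s≤s (n≤1+n m)) (Unique-∷⁺ b∉[a] ([] ∷ [])) (b∈R ∷ a∈R ∷ []) λ where
      x y here               → T-sym a-b
      x y (there (there ()))
    where
    b∉[a] : b ∉ a ∷ []
    b∉[a] (here refl) = T-irrefl a-b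

module _ {m : ℕ} {T : Fin m → Fin m → Set} {L L′ : Fin m} (T-sym : ∀ {a b} → T a b → T b a) (T-irrefl : ∀ {a} → ¬ T a a)
         (leaf : ∀ {h} → T L h → h ≡ L′) where

  Avoiding : Fin m → Fin m → Set
  Avoiding a b = a ≢ L × b ≢ L × T a b

  avoid-leaf : ∀ {a b} → Star T a b → b ≢ L → (a ≢ L → Star Avoiding a b) × (a ≡ L → Star Avoiding L′ b)
  avoid-leaf ε b≢L = (λ _ → ε) , λ a≡L → ⊥-elim (b≢L a≡L)
  avoid-leaf {a} {b} (_◅_ {j = c} a-c rest) b≢L = from-a , from-L
    where
    from-a : a ≢ L → Star Avoiding a b
    from-a a≢L with c ≟ L
    ... | yes refl = subst (λ z → Star Avoiding z b) (sym (leaf (T-sym a-c))) (proj₂ (avoid-leaf rest b≢L) refl)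
    ... | no c≢L   = (a≢L , c≢L , a-c) ◅ proj₁ (avoid-leaf rest b≢L) c≢L
    from-L : a ≡ L → Star Avoiding L′ b
    from-L refl = subst (λ z → Star Avoiding z b) (leaf a-c) (proj₁ (avoid-leaf rest b≢L) λ { refl → T-irrefl a-c })

-- Homotopy of closed walks

module _ {n f : ℕ} (F : Fin f → List (Fin n)) where

  private variable
    X Y X′ Y′ : List (Fin n)

  EdgesInEG : List (Fin n) → Set
  EdgesInEG l = ∀ u v → Adjacent l u v → EdgeK F u v

  record IsCycle (D : List (Fin n)) : Set where
    field
      vertices-unique : Unique D
      length≥3        : 3 ≤ length D
      edges           : EdgesInEG D

  Move-cast : X ≡ X′ → Y ≡ Y′ → Move F X Y → Move F X′ Y′
  Move-cast refl refl m = m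

  Move-++ˡ : ∀ a → Move F X Y → Move F (a ++ X) (a ++ Y)
  Move-++ˡ a (spur a′ b′ x y e)       = Move-cast (++-assoc a a′ _) (++-assoc a a′ _) (spur (a ++ a′) b′ x y e)
  Move-++ˡ a (face a′ b′ i p q x e)    = Move-cast (++-assoc a a′ _) (++-assoc a a′ _) (face (a ++ a′) b′ i p q x e)
  Move-++ˡ a (faceRev a′ b′ i p q x e) = Move-cast (++-assoc a a′ _) (++-assoc a a′ _) (faceRev (a ++ a′) b′ i p q x e)

  Move-++ʳ : ∀ b → Move F X Y → Move F (X ++ b) (Y ++ b)
  Move-++ʳ b (spur a′ b′ x y e) =
    Move-cast (sym (++-assoc a′ _ b)) (sym (++-assoc a′ _ b)) (spur a′ (b′ ++ b) x y e)
  Move-++ʳ b (face a′ b′ i p q x e) =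
    Move-cast (sym (++-assoc a′ _ b)) (sym (trans (++-assoc a′ _ b) (cong (λ T → a′ ++ x ∷ T) loop))) (face a′ (b′ ++ b) i p q x e)
    where loop : (q ++ p ++ x ∷ b′) ++ b ≡ q ++ p ++ x ∷ b′ ++ b
          loop = trans (++-assoc q _ b) (cong (q ++_) (++-assoc p _ b))
  Move-++ʳ b (faceRev a′ b′ i p q x e) =
    Move-cast (sym (++-assoc a′ _ b)) (sym (trans (++-assoc a′ _ b) (cong (λ T → a′ ++ x ∷ T) (++-assoc (reverse (q ++ p)) _ b))))
      (faceRev a′ (b′ ++ b) i p q x e)

  private
    reverse-++-∷ : ∀ (a : List (Fin n)) x b → reverse (a ++ x ∷ b) ≡ reverse b ++ x ∷ reverse a
    reverse-++-∷ a x b =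
      trans (reverse-++ a (x ∷ b)) (trans (cong (_++ reverse a) (unfold-reverse x b)) (++-assoc (reverse b) (x ∷ []) (reverse a)))

    reverse-loop : ∀ (a L : List (Fin n)) x b → reverse (a ++ x ∷ L ++ x ∷ b) ≡ reverse b ++ x ∷ reverse L ++ x ∷ reverse a
    reverse-loop a L x b =
      trans (reverse-++-∷ a x (L ++ x ∷ b))
            (trans (cong (_++ x ∷ reverse a) (reverse-++-∷ L x b)) (++-assoc (reverse b) (x ∷ reverse L) (x ∷ reverse a)))

  Move-reverse : Move F X Y → Move F (reverse X) (reverse Y)
  Move-reverse (spur a b x y e) =
    Move-cast (sym (reverse-++-∷ a x b)) (sym (reverse-loop a (y ∷ []) x b)) (spur (reverse b) (reverse a) x y e)
  Move-reverse (face a b i p q x e) =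
    Move-cast (sym (reverse-++-∷ a x b))
              (sym (trans (cong (λ T → reverse (a ++ x ∷ T)) (sym (++-assoc q p (x ∷ b)))) (reverse-loop a (q ++ p) x b)))
              (faceRev (reverse b) (reverse a) i p q x e)
  Move-reverse (faceRev a b i p q x e) =
    Move-cast (sym (reverse-++-∷ a x b))
              (sym (trans (reverse-loop a (reverse (q ++ p)) x b)
                          (cong (λ T → reverse b ++ x ∷ T ++ x ∷ reverse a) (reverse-involutive (q ++ p)))))
              (Move-cast refl (cong (λ T → reverse b ++ x ∷ T) (sym (++-assoc q p (x ∷ reverse a))))
                         (face (reverse b) (reverse a) i p q x e))

  Homotopic-context : ∀ a b → Homotopic F X Y → Homotopic F (a ++ X ++ b) (a ++ Y ++ b)
  Homotopic-context a b = EqClosure.gmap (λ W → a ++ W ++ b) (Move-++ˡ a ∘ Move-++ʳ b)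

  Homotopic-reverse : Homotopic F X Y → Homotopic F (reverse X) (reverse Y)
  Homotopic-reverse = EqClosure.gmap reverse Move-reverse

  open SetoidReasoning (EqClosure.setoid (Move F))
  open MonoidSolver (++-monoid (Fin n)) using (solve; _⊕_; _⊜_) renaming (id to nil)

  there-and-back : ∀ c A′ d → (∀ u v → Consecutive (c ∷ A′ ∷ʳ d) u v → EdgeK F u v) →
                   Homotopic F (c ∷ A′ ++ d ∷ reverse A′ ∷ʳ c) (c ∷ [])
  there-and-back c []       d edge = bwd (spur [] [] c d (edge c d here)) ◅ ε
  there-and-back c (e ∷ A′) d edge = begin
    c ∷ e ∷ A′ ++ d ∷ reverse (e ∷ A′) ∷ʳ c              ≡⟨ reassoc ⟩
    (c ∷ []) ++ (e ∷ A′ ++ d ∷ reverse A′ ∷ʳ e) ++ c ∷ []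
      ≈⟨ Homotopic-context (c ∷ []) (c ∷ []) (there-and-back e A′ d (λ u v → edge u v ∘ there)) ⟩
    c ∷ e ∷ c ∷ []                                       ≈⟨ bwd (spur [] [] c e (edge c e here)) ◅ ε ⟩
    c ∷ []                                               ∎
    where
    reassoc : c ∷ e ∷ A′ ++ d ∷ reverse (e ∷ A′) ∷ʳ c ≡ c ∷ e ∷ (A′ ++ d ∷ reverse A′ ∷ʳ e) ++ c ∷ []
    reassoc = trans (cong (λ T → c ∷ e ∷ A′ ++ d ∷ T ∷ʳ c) (unfold-reverse e A′))
                    (sym (cong (λ T → c ∷ e ∷ T) (++-assoc A′ (d ∷ reverse A′ ∷ʳ e) (c ∷ []))))

  Contractible-rotate : ∀ X Y → EdgesInEG (X ++ Y) → Contractible F (Y ++ X) → Contractible F (X ++ Y)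
  Contractible-rotate []       Y        _     h = subst (Contractible F) (++-identityʳ Y) h
  Contractible-rotate (c ∷ A′) []       _     h = subst (Contractible F) (sym (++-identityʳ (c ∷ A′))) h
  Contractible-rotate (c ∷ A′) (d ∷ B′) edges h = begin
    (c ∷ A′ ++ d ∷ B′) ++ c ∷ []                                  ≈⟨ Homotopic-context (c ∷ A′ ++ d ∷ B′) [] back ⟨
    (c ∷ A′ ++ d ∷ B′) ++ (c ∷ A′ ++ d ∷ reverse A′ ∷ʳ c) ++ []   ≡⟨ reassoc ⟩
    (c ∷ A′) ++ (d ∷ B′ ++ c ∷ A′ ∷ʳ d) ++ reverse A′ ∷ʳ c
      ≈⟨ Homotopic-context (c ∷ A′) (reverse A′ ∷ʳ c) h′ ⟩
    (c ∷ A′) ++ (d ∷ []) ++ reverse A′ ∷ʳ c                       ≈⟨ back ⟩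
    c ∷ []                                                        ∎
    where
    back : Homotopic F (c ∷ A′ ++ d ∷ reverse A′ ∷ʳ c) (c ∷ [])
    back = there-and-back c A′ d λ u v p →
      edges u v (inj₁ (Consecutive-cast (sym (closedWalk-++ c A′ d B′)) (Consecutive-∷ʳ-++⁺ (c ∷ A′) d (B′ ∷ʳ c) p)))
    reassoc : (c ∷ A′ ++ d ∷ B′) ++ (c ∷ A′ ++ d ∷ reverse A′ ∷ʳ c) ++ [] ≡
              (c ∷ A′) ++ (d ∷ B′ ++ c ∷ A′ ∷ʳ d) ++ reverse A′ ∷ʳ c
    reassoc = solve 5 (λ C D A B R → (C ⊕ A ⊕ D ⊕ B) ⊕ (C ⊕ A ⊕ D ⊕ R ⊕ C) ⊕ nil
                                   ⊜ (C ⊕ A) ⊕ (D ⊕ B ⊕ C ⊕ A ⊕ D) ⊕ R ⊕ C)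
                      refl (c ∷ []) (d ∷ []) A′ B′ (reverse A′)
    h′ : Homotopic F (d ∷ B′ ++ c ∷ A′ ∷ʳ d) (d ∷ [])
    h′ = subst (λ W → Homotopic F (d ∷ W) (d ∷ [])) (++-assoc B′ (c ∷ A′) (d ∷ [])) h

  Contractible-reflect : ∀ c cs → Contractible F (c ∷ reverse cs) → Contractible F (c ∷ cs)
  Contractible-reflect c cs h = begin
    closedWalk (c ∷ cs)                              ≡⟨ cong (λ T → closedWalk (c ∷ T)) (reverse-involutive cs) ⟨
    closedWalk (c ∷ reverse (reverse cs))            ≡⟨ closedWalk-reverse c (reverse cs) ⟨
    reverse (closedWalk (c ∷ reverse cs))            ≈⟨ Homotopic-reverse h ⟩
    c ∷ []                                           ∎

  CycleStep-contractible : CycleStep X Y → EdgesInEG X → Contractible F Y → Contractible F X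
  CycleStep-contractible (rotate X Y)   edges = Contractible-rotate X Y edges
  CycleStep-contractible (reflect c cs) _     = Contractible-reflect c cs

  ≋-contractible : X ≋ Y → EdgesInEG X → Contractible F Y → Contractible F X
  ≋-contractible ε        _     h = h
  ≋-contractible (s ◅ ss) edges h =
    CycleStep-contractible s edges (≋-contractible ss (λ u v → edges u v ∘ CycleStep-adjacent (CycleStep-sym s)) h)

  Contractible-shortcut : ∀ x P y rest → EdgeK F y x → (∀ a b → Move F (a ++ x ∷ b) (a ++ x ∷ P ++ y ∷ x ∷ b)) →
                          Contractible F (x ∷ y ∷ rest) → Contractible F (x ∷ P ++ y ∷ rest)
  Contractible-shortcut x P y rest y-x insert-face h = begin
    x ∷ (P ++ y ∷ rest) ++ x ∷ []        ≡⟨ cong (x ∷_) (++-assoc P (y ∷ rest) (x ∷ [])) ⟩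
    (x ∷ P) ++ y ∷ rest ∷ʳ x             ≈⟨ fwd (spur (x ∷ P) (rest ∷ʳ x) y x y-x) ◅ ε ⟩
    (x ∷ P) ++ y ∷ x ∷ y ∷ rest ∷ʳ x     ≈⟨ bwd (insert-face [] (y ∷ rest ∷ʳ x)) ◅ ε ⟩
    x ∷ y ∷ rest ∷ʳ x                    ≈⟨ h ⟩
    x ∷ []                               ∎

-- Polyhedral maps

module _ (F : Fin f → List (Fin n)) where

  coAdj-side : ∀ D → CoAdj F D a b → ∃₂ λ x y → Side (F a) x y × Side (F b) x y × ¬ Side D x y
  coAdj-side D ((a≢b , x , y , sa , sb) , ∉E) = x , y , sa , sb , λ sD → ∉E (a≢b , x , y , sD , sa , sb)

  coAdj-≢ : ∀ D → CoAdj F D a b → a ≢ b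
  coAdj-≢ D ((a≢b , _) , _) = a≢b

  AdjM? : ∀ i j → Dec (AdjM F i j)
  AdjM? i j = ¬? (i ≟ j) ×-dec anyFin? λ u → anyFin? λ v → Side? (F i) u v ×-dec Side? (F j) u v

  InE? : ∀ D i j → Dec (InE F D i j)
  InE? D i j = ¬? (i ≟ j) ×-dec anyFin? λ u → anyFin? λ v → Side? D u v ×-dec Side? (F i) u v ×-dec Side? (F j) u v

  CoAdj? : ∀ D i j → Dec (CoAdj F D i j)
  CoAdj? D i j = AdjM? i j ×-dec ¬? (InE? D i j)

module _ {F : Fin f → List (Fin n)} (PM : PolyhedralMap F) where
  open PolyhedralMap PM

  face-unique : ∀ g → Unique (F g)
  face-unique g = proj₂ (polygon g)

  face-length : ∀ g → 3 ≤ length (F g)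
  face-length g = proj₁ (polygon g)

  Side-≢ : Side (F g) u v → u ≢ v
  Side-≢ {g = g} s = Adjacent-≢ (face-unique g) (≤-trans (n≤1+n 2) (face-length g)) (Side⇒Adjacent s)

  faces-at-side : Side (F a) u v → Side (F b) u v → a ≢ b → Side (F k) u v → k ≡ a ⊎ k ≡ b
  faces-at-side {a = a} {u = u} {v = v} {b = b} sa sb a≢b sk with twoFaces u v (a , sa)
  ... | i , j , i≢j , _ , _ , only with only a sa | only b sb | only _ sk
  ... | inj₁ refl | inj₁ refl | _         = ⊥-elim (a≢b refl)
  ... | inj₂ refl | inj₂ refl | _         = ⊥-elim (a≢b refl)
  ... | inj₁ refl | inj₂ refl | k≡i       = k≡i
  ... | inj₂ refl | inj₁ refl | k≡i       = swap k≡i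

  opposite-face : Side (F a) u v → ∃ λ b → b ≢ a × Side (F b) u v
  opposite-face {a = a} {u = u} {v = v} sa with twoFaces u v (a , sa)
  ... | i , j , i≢j , si , sj , only with only a sa
  ... | inj₁ refl = j , ≢-sym i≢j , sj
  ... | inj₂ refl = i , i≢j , si

  shared-side-unique : i ≢ j → Side (F i) x y → Side (F j) x y → Side (F i) u v → Side (F j) u v → SameEdge u v x y
  shared-side-unique {i = i} {j = j} {x = x} i≢j sx sx′ su su′ with polyhedral i j i≢j
  ... | inj₁ disjoint = ⊥-elim (disjoint x (proj₁ (Side-∈ sx)) (proj₁ (Side-∈ sx′)))
  ... | inj₂ (inj₁ (_ , only)) =
    ⊥-elim (Side-≢ sx (trans (only _ (proj₁ (Side-∈ sx)) (proj₁ (Side-∈ sx′)))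
                             (sym (only _ (proj₂ (Side-∈ sx)) (proj₂ (Side-∈ sx′))))))
  ... | inj₂ (inj₂ (s , t , _ , _ , only)) = same-pair (endpoints sx sx′) (endpoints su su′) (Side-≢ sx) (Side-≢ su)
    where
    endpoints : ∀ {p q} → Side (F i) p q → Side (F j) p q → (p ≡ s ⊎ p ≡ t) × (q ≡ s ⊎ q ≡ t)
    endpoints sp sp′ = only _ (proj₁ (Side-∈ sp)) (proj₁ (Side-∈ sp′)) , only _ (proj₂ (Side-∈ sp)) (proj₂ (Side-∈ sp′))

  coAdj : ∀ D → a ≢ b → Side (F a) x y → Side (F b) x y → ¬ Side D x y → CoAdj F D a b
  coAdj D a≢b sa sb x-y∉D = (a≢b , _ , _ , sa , sb) , not-in-E
    where
    not-in-E : ¬ InE F D _ _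
    not-in-E (_ , u , v , sD , su , su′) = x-y∉D (resp-SameEdge {P = Side D} swap (SameEdge-sym (shared-side-unique a≢b sa sb su su′)) sD)

  coAdj-sym : ∀ D → CoAdj F D a b → CoAdj F D b a
  coAdj-sym D c with coAdj-side F D c
  ... | _ , _ , sa , sb , ∉D = coAdj D (≢-sym (coAdj-≢ F D c)) sb sa ∉D

  other-side-at : Side (F g) v x → ∃ λ y → Side (F g) v y × y ≢ x × (∀ z → Side (F g) v z → z ≡ x ⊎ z ≡ y)
  other-side-at {g = g} s with other-neighbour (face-unique g) (face-length g) (Side⇒Adjacent s)
  ... | y , adj , y≢x , only = y , Adjacent⇒Side adj , y≢x , λ z → only z ∘ Side⇒Adjacent

  face-vertex : ∀ g → ∃ λ v → v ∈ F g
  face-vertex g with F g | face-length g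
  ... | v ∷ _ | _ = v , here refl

  face-contractible : ∀ g → Contractible F (F g)
  face-contractible g with F g in eq | face-length g
  ... | x ∷ q | _ = bwd (face [] [] g [] q x eq) ◅ ε

  record Opening (g : Fin f) (x y : Fin n) : Set where
    field
      path   : List (Fin n)
      cycle  : F g ≋ x ∷ path ∷ʳ y
      insert : ∀ a b → Move F (a ++ x ∷ b) (a ++ x ∷ path ++ y ∷ x ∷ b)

  open-side : Side (F g) x y → Opening g x y
  open-side {g = g} {x = x} {y = y} s = opening (∈-∃++ (proj₁ (Side-∈ s)))
    where
    rotated : ∀ {p q} → F g ≡ p ++ x ∷ q → F g ≋ x ∷ q ++ p
    rotated {p} {q} eq = subst (_≋ x ∷ q ++ p) (sym eq) (rotate p (x ∷ q) ◅ ε)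
    opening : (∃₂ λ p q → F g ≡ p ++ x ∷ q) → Opening g x y
    opening (p , q , eq)
      with adjacent-head (q ++ p) (≋-unique (rotated eq) (face-unique g)) (≢-sym (Side-≢ s)) (≋-adjacent (rotated eq) (Side⇒Adjacent s))
    ... | inj₁ (M , q++p≡y∷M) = record
      { path   = reverse M
      ; cycle  = rotated eq ◅◅ subst (λ W → CycleStep (x ∷ q ++ p) (x ∷ W)) reversed (reflect x (q ++ p)) ◅ ε
      ; insert = λ a b → Move-cast F refl (cong (λ W → a ++ x ∷ W) (trans (cong (_++ x ∷ b) reversed) (++-assoc (reverse M) (y ∷ []) (x ∷ b))))
                                     (faceRev a b g p q x eq)
      }
      where
      reversed : reverse (q ++ p) ≡ reverse M ∷ʳ y
      reversed = trans (cong reverse q++p≡y∷M) (unfold-reverse y M)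
    ... | inj₂ (M , q++p≡M∷ʳy) = record
      { path   = M
      ; cycle  = subst (λ W → F g ≋ x ∷ W) q++p≡M∷ʳy (rotated eq)
      ; insert = λ a b → Move-cast F refl (cong (λ W → a ++ x ∷ W) (trans (sym (++-assoc q p (x ∷ b)))
                                     (trans (cong (_++ x ∷ b) q++p≡M∷ʳy) (++-assoc M (y ∷ []) (x ∷ b)))))
                                     (face a b g p q x eq)
      }

-- Faces linked across sides off a cycle

module Connectivity {n f : ℕ} {F : Fin f → List (Fin n)} (PM : PolyhedralMap F) (C : List (Fin n)) (C-cycle : IsCycle F C) where

  open PolyhedralMap PM
  open IsCycle C-cycle renaming (vertices-unique to C-unique; length≥3 to C-length; edges to C-edges)
  open DecMembership (_≟_ {f}) using (_∈?_)

  infix 4 _~_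
  _~_ : Fin f → Fin f → Set
  _~_ = Star (CoAdj F C)

  module AroundVertex (v u w : Fin n) (C-at-v : ∀ y → Side C v y → y ≡ u ⊎ y ≡ w) (u≢w : u ≢ w)
                      (vw-edge : EdgeK F v w) (P : Fin f) (P-vu : Side (F P) v u) where

    -- Walking around v from P: g is the current face, entered through its side vx; V lists the faces visited.
    record Arc (g : Fin f) (x : Fin n) (V : List (Fin f)) : Set where
      field
        entry          : Side (F g) v x
        visited-unique : Unique V
        current∈       : g ∈ V
        start∈         : P ∈ V
        reachable      : ∀ h → h ∈ V → P ~ h
        at-start       : g ≡ P → x ≡ u
        entry≢w        : x ≢ w
        entry-closed   : x ≢ u → ∀ k → Side (F k) v x → k ∈ V
        sealed         : ∀ h → h ∈ V → h ≢ g → ∀ y → Side (F h) v y →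
                         y ≢ w × (y ≢ u → (∀ k → Side (F k) v y → k ∈ V) × (Side (F g) v y → y ≡ x))

    start : Arc P u (P ∷ [])
    start = record
      { entry = P-vu ; visited-unique = [] ∷ [] ; current∈ = here refl ; start∈ = here refl
      ; reachable = λ { h (here refl) → ε }
      ; at-start = λ _ → refl ; entry≢w = u≢w ; entry-closed = λ u≢u → ⊥-elim (u≢u refl)
      ; sealed = λ { h (here refl) h≢P → ⊥-elim (h≢P refl) }
      }

    module _ {g x V} (arc : Arc g x V) (g-vu : Side (F g) v u) (u≢x : u ≢ x)
             (only : ∀ z → Side (F g) v z → z ≡ x ⊎ z ≡ u) where
      open Arc arc

      private
        W : Fin f
        W = proj₁ vw-edge

        W-vw : Side (F W) v w
        W-vw = proj₂ vw-edge

        faces-at-vu : ∀ k → Side (F k) v u → k ∈ V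
        faces-at-vu k s with faces-at-side PM g-vu P-vu (λ g≡P → u≢x (sym (at-start g≡P))) s
        ... | inj₁ refl = current∈
        ... | inj₂ refl = start∈

        link-closed : ∀ h k → h ∈ V → LinkAdj F v h k → k ∈ V
        link-closed h k h∈V (y , h-vy , k-vy) with h ≟ g | y ≟ u
        ... | _        | yes refl = faces-at-vu k k-vy
        ... | yes refl | no y≢u with only y h-vy
        ...   | inj₁ refl = entry-closed y≢u k k-vy
        ...   | inj₂ refl = ⊥-elim (y≢u refl)
        link-closed h k h∈V (y , h-vy , k-vy) | no h≢g | no y≢u = proj₁ (proj₂ (sealed h h∈V h≢g y h-vy) y≢u) k k-vy

        reach : ∀ {a b} → Star (LinkAdj F v) a b → a ∈ V → b ∈ V
        reach ε           a∈V = a∈V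
        reach (step ◅ ss) a∈V = reach ss (link-closed _ _ a∈V step)

      arc-cannot-close : ⊥
      arc-cannot-close with W ≟ g
      ... | yes refl = [ entry≢w ∘ sym , u≢w ∘ sym ] (only w W-vw)
      ... | no W≢g   = proj₁ (sealed W W∈V W≢g w W-vw) refl
        where
        W∈V : W ∈ V
        W∈V = reach (diskLink v P W (proj₁ (Side-∈ P-vu)) (proj₁ (Side-∈ W-vw))) start∈

    arc-step : ∀ {g x V y g′} → Arc g x V → Side (F g) v y → y ≢ x → (∀ z → Side (F g) v z → z ≡ x ⊎ z ≡ y) →
               y ≢ w → y ≢ u → g′ ≢ g → Side (F g′) v y → g′ ∉ V → Arc g′ y (g′ ∷ V)
    arc-step {g} {x} {V} {y} {g′} arc g-vy y≢x only y≢w y≢u g′≢g g′-vy g′∉V = record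
      { entry = g′-vy
      ; visited-unique = Unique-∷⁺ g′∉V visited-unique
      ; current∈ = here refl
      ; start∈ = there start∈
      ; reachable = λ { h (here refl) → reachable g current∈ ◅◅ coAdj PM C (≢-sym g′≢g) g-vy g′-vy y∉C ◅ ε
                      ; h (there h∈V) → reachable h h∈V }
      ; at-start = λ { refl → ⊥-elim (g′∉V start∈) }
      ; entry≢w = y≢w
      ; entry-closed = λ _ → faces-at-vy
      ; sealed = sealed′
      }
      where
      open Arc arc
      y∉C : ¬ Side C v y
      y∉C s = [ y≢u , y≢w ] (C-at-v y s)
      faces-at-vy : ∀ k → Side (F k) v y → k ∈ g′ ∷ V
      faces-at-vy k s with faces-at-side PM g-vy g′-vy (≢-sym g′≢g) s
      ... | inj₁ refl = there current∈
      ... | inj₂ refl = here refl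
      sealed′ : ∀ h → h ∈ g′ ∷ V → h ≢ g′ → ∀ z → Side (F h) v z →
                z ≢ w × (z ≢ u → (∀ k → Side (F k) v z → k ∈ g′ ∷ V) × (Side (F g′) v z → z ≡ y))
      sealed′ h (here refl)  h≢g′ = ⊥-elim (h≢g′ refl)
      sealed′ h (there h∈V) h≢g′ z h-vz with h ≟ g
      ... | no h≢g = proj₁ old , λ z≢u → (λ k → there ∘ proj₁ (proj₂ old z≢u) k) , λ g′-vz → ⊥-elim (g′∉V (proj₁ (proj₂ old z≢u) g′ g′-vz))
        where
        old : z ≢ w × (z ≢ u → (∀ k → Side (F k) v z → k ∈ V) × (Side (F g) v z → z ≡ x))
        old = sealed h h∈V h≢g z h-vz
      ... | yes refl with only z h-vz
      ...   | inj₁ refl = entry≢w , λ x≢u → (λ k → there ∘ entry-closed x≢u k) , λ g′-vx → ⊥-elim (g′∉V (entry-closed x≢u g′ g′-vx))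
      ...   | inj₂ refl = y≢w , λ _ → faces-at-vy , λ _ → refl

    walk : ∀ fuel {g x V} → f < length V + fuel → Arc g x V → ∃ λ Y → Side (F Y) v w × P ~ Y
    walk zero       {V = V} bound arc = ⊥-elim (<-irrefl refl (<-≤-trans (subst (f <_) (+-identityʳ (length V)) bound) (Unique-length≤ (Arc.visited-unique arc))))
    walk (suc fuel) {g} {x} {V} bound arc with other-side-at PM (Arc.entry arc)
    ... | y , g-vy , y≢x , only with y ≟ w | y ≟ u
    ...   | yes refl | _        = g , g-vy , Arc.reachable arc g (Arc.current∈ arc)
    ...   | no _     | yes refl = ⊥-elim (arc-cannot-close arc g-vy y≢x only)
    ...   | no y≢w   | no y≢u with opposite-face PM g-vy
    ...     | g′ , g′≢g , g′-vy with g′ ∈? V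
    ...       | yes g′∈V = ⊥-elim (y≢x (proj₂ (proj₂ (Arc.sealed arc g′ g′∈V g′≢g y g′-vy) y≢u) g-vy))
    ...       | no g′∉V  = walk fuel (subst (f <_) (+-suc (length V) fuel) bound) (arc-step arc g-vy y≢x only y≢w y≢u g′≢g g′-vy g′∉V)

    reach-other-side : ∃ λ Y → Side (F Y) v w × P ~ Y
    reach-other-side = walk (suc f) (s≤s (n≤1+n f)) start

  C-neighbours : ∀ {v a c} → Side C v a → Side C v c → a ≢ c → ∀ y → Side C v y → y ≡ a ⊎ y ≡ c
  C-neighbours sa sc a≢c y sy =
    neighbours-unique C-unique C-length (Side⇒Adjacent sa) (Side⇒Adjacent sc) a≢c (Side⇒Adjacent sy)

  around-vertex : ∀ {v a c} → Side C v a → Side C v c → ∀ X → Side (F X) v a → ∃ λ Y → Side (F Y) v c × X ~ Y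
  around-vertex {v} {a} {c} sa sc X sX with a ≟ c
  ... | yes refl = X , sX , ε
  ... | no a≢c   = AroundVertex.reach-other-side v a c (C-neighbours sa sc a≢c) a≢c (C-edges v c (Side⇒Adjacent sc)) X sX

  module _ (A₀ B₀ : Fin f) where

    Reaches : Fin n → Fin n → Set
    Reaches a b = ∀ X → Side (F X) a b → X ~ A₀ ⊎ X ~ B₀

    Reaches-step : ∀ {a b c} → Side C a b → Side C b c → Reaches a b → Reaches b c
    Reaches-step sab sbc r X sX with around-vertex sbc (swap sab) X sX
    ... | Y , sY , X~Y = ⊎-map (X~Y ◅◅_) (X~Y ◅◅_) (r Y (swap sY))

    Reaches-everywhere : ∀ {x₀ y₀} → Side C x₀ y₀ → Reaches x₀ y₀ → ∀ p q → Side C p q → Reaches p q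
    Reaches-everywhere {x₀} {y₀} s₀ r₀ p q spq
      with ≋-orient C-unique (Adjacent-≢ C-unique (≤-trans (n≤1+n 2) C-length) (Side⇒Adjacent s₀)) (Side⇒Adjacent s₀)
    ... | rest , e = [ along , (λ r X → r X ∘ swap) ∘ along ] (≋-adjacent e (Side⇒Adjacent spq))
      where
      on-C : ∀ {a b} → Consecutive (closedWalk (x₀ ∷ y₀ ∷ rest)) a b → Side C a b
      on-C c = Adjacent⇒Side (≋-adjacent (≋-sym e) (inj₁ c))
      along : ∀ {a b} → Consecutive (closedWalk (x₀ ∷ y₀ ∷ rest)) a b → Reaches a b
      along = Consecutive-propagate x₀ y₀ (rest ∷ʳ x₀) (λ c c′ → Reaches-step (on-C c) (on-C c′)) r₀

    every-face-reaches : (∀ v → v ∈ C) → (∀ p q → Side C p q → Reaches p q) → ∀ j → j ~ A₀ ⊎ j ~ B₀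
    every-face-reaches all∈C reaches j with face-vertex PM j
    ... | v , v∈j with some-neighbour (≤-trans (n≤1+n 2) C-length) (all∈C v)
    ... | s , v-s with C-edges v s v-s
    ... | W , W-vs = along-link (diskLink v j W v∈j (proj₁ (Side-∈ W-vs)))
      where
      along-link : ∀ {k} → Star (LinkAdj F v) k W → k ~ A₀ ⊎ k ~ B₀
      along-link ε = reaches v s (Adjacent⇒Side v-s) W W-vs
      along-link {k} (_◅_ {j = k′} (y , k-vy , k′-vy) rest) with Side? C v y | k ≟ k′
      ... | yes vy∈C | _        = reaches v y vy∈C k k-vy
      ... | no _     | yes refl = along-link rest
      ... | no vy∉C  | no k≢k′  = ⊎-map (coAdj PM C k≢k′ k-vy k′-vy vy∉C ◅_) (coAdj PM C k≢k′ k-vy k′-vy vy∉C ◅_) (along-link rest)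

  faces-reach-side : (∀ v → v ∈ C) → ∀ {u v g h} → Side C u v → Side (F g) u v → Side (F h) u v → g ≢ h →
                     ∀ j → j ~ g ⊎ j ~ h
  faces-reach-side all∈C {u} {v} {g} {h} suv sg sh g≢h =
    every-face-reaches g h all∈C (Reaches-everywhere g h suv at-side)
    where
    at-side : Reaches g h u v
    at-side X sX = ⊎-map (λ { refl → ε }) (λ { refl → ε }) (faces-at-side PM sg sh g≢h sX)

-- Trees of faces bounded by a cycle

module _ {n f : ℕ} {F : Fin f → List (Fin n)} (PM : PolyhedralMap F) where

  -- R is a region of faces bounded by D (sides on D lead out of R, all other sides stay inside)
  -- whose dual graph is a tree.
  record TreeRegion (D : List (Fin n)) (R : List (Fin f)) : Set where
    field
      faces-unique : Unique R
      boundary     : ∀ {g h u v} → g ∈ R → Side (F g) u v → Side D u v → h ≢ g → Side (F h) u v → h ∉ R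
      interior     : ∀ {g h u v} → g ∈ R → Side (F g) u v → ¬ Side D u v → Side (F h) u v → h ∈ R
      connected    : ∀ a b → a ∈ R → b ∈ R → Star (Within R (CoAdj F D)) a b
      acyclic      : ¬ HasCycle (Within R (CoAdj F D))

  single-face-contractible : ∀ {D L} → IsCycle F D → TreeRegion D (L ∷ []) → Contractible F D
  single-face-contractible {D} {L} cycle region =
    ≋-contractible F (≋-cycle vertices-unique (face-unique PM L) (face-length PM L) sides-on-D) edges (face-contractible PM L)
    where
    open IsCycle cycle
    sides-on-D : ∀ a b → Adjacent (F L) a b → Adjacent D a b
    sides-on-D a b adj with Side? D a b
    ... | yes s   = Side⇒Adjacent s
    ... | no ab∉D with opposite-face PM (Adjacent⇒Side adj)
    ...   | h , h≢L , h-ab with TreeRegion.interior region (here refl) (Adjacent⇒Side adj) ab∉D h-ab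
    ...     | here h≡L = ⊥-elim (h≢L h≡L)

  module LeafRemoval {D R L L′ x y} (cycle : IsCycle F D) (region : TreeRegion D R) (L∈R : L ∈ R) (L′∈R : L′ ∈ R)
                     (L≢L′ : L ≢ L′) (only-L′ : ∀ h → h ∈ R → CoAdj F D L h → h ≡ L′)
                     (L-xy : Side (F L) x y) (L′-xy : Side (F L′) x y) (xy∉D : ¬ Side D x y) where

    open IsCycle cycle
    open TreeRegion region
    open Opening (open-side PM L-xy) renaming (cycle to L≋path)

    leaf-side : ∀ {u v} → Side (F L) u v → ¬ Side D u v → SameEdge u v x y
    leaf-side {u} {v} L-uv uv∉D with opposite-face PM L-uv
    ... | h , h≢L , h-uv =
      shared-side-unique PM L≢L′ L-xy L′-xy L-uv
        (subst (λ k → Side (F k) u v) (only-L′ h (interior L∈R L-uv uv∉D h-uv) (coAdj PM D (≢-sym h≢L) L-uv h-uv uv∉D)) h-uv)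

    path-unique : Unique (x ∷ path ∷ʳ y)
    path-unique = ≋-unique L≋path (face-unique PM L)

    path-length : 3 ≤ length (x ∷ path ∷ʳ y)
    path-length = subst (3 ≤_) (≋-length L≋path) (face-length PM L)

    on-L : ∀ {u v} → Linked (x ∷ path ∷ʳ y) u v → Side (F L) u v
    on-L l = Adjacent⇒Side (≋-adjacent (≋-sym L≋path) (Linked⇒Adjacent l))

    path-on-D : ∀ a b → Consecutive (x ∷ path ∷ʳ y) a b → Adjacent D a b
    path-on-D a b c with Side? D a b
    ... | yes ab∈D = Side⇒Adjacent ab∈D
    ... | no ab∉D  = ⊥-elim (ends-not-linked x path y path-unique path-length
                              (resp-SameEdge swap (SameEdge-sym (leaf-side (on-L (inj₁ c)) ab∉D)) (inj₁ c)))

    D-contains-path : ∃ λ rest → D ≋ x ∷ path ++ y ∷ rest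
    D-contains-path with ≋-path vertices-unique (x ∷ path ∷ʳ y) path-unique (≤-trans (n≤1+n 2) path-length) path-on-D
    ... | rest , e = rest , subst (D ≋_) (cong (x ∷_) (++-assoc path (y ∷ []) rest)) e

    module Shortcut {rest R′} (e : D ≋ x ∷ path ++ y ∷ rest) (R↭ : R ↭ L ∷ R′) where

      D′ : List (Fin n)
      D′ = x ∷ y ∷ rest

      D-side : ∀ {u v} → Side D u v → Linked (x ∷ path ∷ʳ y) u v ⊎ Linked (y ∷ rest ∷ʳ x) u v
      D-side s = Adjacent-split x path y rest (≋-adjacent e (Side⇒Adjacent {l = D} s))

      D′-side : ∀ {u v} → Side D′ u v → SameEdge u v x y ⊎ Linked (y ∷ rest ∷ʳ x) u v
      D′-side s = ⊎-map Linked-pair id (Adjacent-split x [] y rest (Side⇒Adjacent {l = D′} s))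

      kept-in-D : ∀ {u v} → Linked (y ∷ rest ∷ʳ x) u v → Side D u v
      kept-in-D l = Adjacent⇒Side (≋-adjacent (≋-sym e) (Linked⇒Adjacentʳ x path y rest l))

      kept-in-D′ : ∀ {u v} → Linked (y ∷ rest ∷ʳ x) u v → Side D′ u v
      kept-in-D′ l = Adjacent⇒Side {l = D′} (Linked⇒Adjacentʳ x [] y rest l)

      xy∈D′ : ∀ {u v} → SameEdge u v x y → Side D′ u v
      xy∈D′ same = resp-SameEdge {P = Side D′} swap same (Adjacent⇒Side {l = D′} (Linked⇒Adjacentˡ x [] y rest (inj₁ here)))

      D′-cycle : IsCycle F D′
      D′-cycle = record
        { vertices-unique = Unique-∷-++⁻ x path (≋-unique e vertices-unique)
        ; length≥3        = three-or-more rest rest≢[]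
        ; edges           = D′-edges
        }
        where
        D′-edges : EdgesInEG F D′
        D′-edges u v adj with D′-side (Adjacent⇒Side {l = D′} adj)
        ... | inj₁ same = L , resp-SameEdge swap same L-xy
        ... | inj₂ l    = edges u v (Side⇒Adjacent (kept-in-D l))
        rest≢[] : rest ≢ []
        rest≢[] refl = xy∉D (swap (Adjacent⇒Side (≋-adjacent (≋-sym e) (Adjacent-last-head x path y))))
        three-or-more : ∀ r → r ≢ [] → 3 ≤ length (x ∷ y ∷ r)
        three-or-more []      r≢[] = ⊥-elim (r≢[] refl)
        three-or-more (_ ∷ _) _    = s≤s (s≤s (s≤s z≤n))

      contractible-back : Contractible F D′ → Contractible F D
      contractible-back h = ≋-contractible F e edges (Contractible-shortcut F x path y rest (L , swap L-xy) insert h)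

      private
        L∷R′-unique : Unique (L ∷ R′)
        L∷R′-unique = Unique-resp-↭ (setoid _) (↭⇒↭ₛ R↭) faces-unique

        R′⊆R : ∀ {h} → h ∈ R′ → h ∈ R
        R′⊆R h∈R′ = ∈-resp-↭ (↭-sym R↭) (there h∈R′)

        R′-≢L : ∀ {h} → h ∈ R′ → h ≢ L
        R′-≢L h∈R′ refl = Unique[x∷xs]⇒x∉xs L∷R′-unique h∈R′

        R⊆R′ : ∀ {h} → h ∈ R → h ≢ L → h ∈ R′
        R⊆R′ h∈R h≢L with ∈-resp-↭ R↭ h∈R
        ... | here h≡L    = ⊥-elim (h≢L h≡L)
        ... | there h∈R′ = h∈R′

        on-xy : ∀ {g} → g ∈ R′ → Side (F g) x y → g ≡ L′
        on-xy g∈R′ g-xy = [ ⊥-elim ∘ R′-≢L g∈R′ , id ] (faces-at-side PM L-xy L′-xy L≢L′ g-xy)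

        D⇒D′ : ∀ {g h} → g ∈ R′ → h ∈ R′ → CoAdj F D g h → CoAdj F D′ g h
        D⇒D′ {g} {h} g∈R′ h∈R′ c with coAdj-side F D c
        ... | u , v , g-uv , h-uv , uv∉D = coAdj PM D′ (coAdj-≢ F D c) g-uv h-uv uv∉D′
          where
          uv∉D′ : ¬ Side D′ u v
          uv∉D′ s with D′-side s
          ... | inj₁ same = coAdj-≢ F D c (trans (on-xy g∈R′ (resp-SameEdge swap (SameEdge-sym same) g-uv))
                                                     (sym (on-xy h∈R′ (resp-SameEdge swap (SameEdge-sym same) h-uv))))
          ... | inj₂ l    = uv∉D (kept-in-D l)

        D′⇒D : ∀ {g h} → g ∈ R′ → h ∈ R′ → CoAdj F D′ g h → CoAdj F D g h
        D′⇒D {g} {h} g∈R′ h∈R′ c with coAdj-side F D′ c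
        ... | u , v , g-uv , h-uv , uv∉D′ = coAdj PM D (coAdj-≢ F D′ c) g-uv h-uv uv∉D
          where
          uv∉D : ¬ Side D u v
          uv∉D s with D-side s
          ... | inj₁ l = [ R′-≢L g∈R′ ∘ sym , R′-≢L h∈R′ ∘ sym ] (faces-at-side PM g-uv h-uv (coAdj-≢ F D′ c) (on-L l))
          ... | inj₂ l = uv∉D′ (kept-in-D′ l)

        boundary′ : ∀ {g h u v} → g ∈ R′ → Side (F g) u v → Side D′ u v → h ≢ g → Side (F h) u v → h ∉ R′
        boundary′ g∈R′ g-uv s h≢g h-uv h∈R′ with D′-side s
        ... | inj₁ same = h≢g (trans (on-xy h∈R′ (resp-SameEdge swap (SameEdge-sym same) h-uv))
                                     (sym (on-xy g∈R′ (resp-SameEdge swap (SameEdge-sym same) g-uv))))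
        ... | inj₂ l    = boundary (R′⊆R g∈R′) g-uv (kept-in-D l) h≢g h-uv (R′⊆R h∈R′)

        interior′ : ∀ {g h u v} → g ∈ R′ → Side (F g) u v → ¬ Side D′ u v → Side (F h) u v → h ∈ R′
        interior′ {g} {h} {u} {v} g∈R′ g-uv uv∉D′ h-uv = R⊆R′ (interior (R′⊆R g∈R′) g-uv uv∉D h-uv) h≢L
          where
          uv∉D : ¬ Side D u v
          uv∉D s with D-side s
          ... | inj₁ l = boundary (R′⊆R g∈R′) g-uv s (≢-sym (R′-≢L g∈R′)) (on-L l) L∈R
          ... | inj₂ l = uv∉D′ (kept-in-D′ l)
          h≢L : h ≢ L
          h≢L refl = uv∉D′ (xy∈D′ (leaf-side h-uv uv∉D))

      L′∈R′ : L′ ∈ R′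
      L′∈R′ = R⊆R′ L′∈R (≢-sym L≢L′)

      region′ : TreeRegion D′ R′
      region′ = record
        { faces-unique = tail L∷R′-unique
        ; boundary     = boundary′
        ; interior     = interior′
        ; connected    = λ a b a∈R′ b∈R′ →
            Star.map (λ { (a≢L , b≢L , a∈R , b∈R , c) → R⊆R′ a∈R a≢L , R⊆R′ b∈R b≢L , D⇒D′ (R⊆R′ a∈R a≢L) (R⊆R′ b∈R b≢L) c })
                     (proj₁ (avoid-leaf Within-sym Within-irrefl (λ { (_ , h∈R , c) → only-L′ _ h∈R c })
                                        (connected a b (R′⊆R a∈R′) (R′⊆R b∈R′)) (R′-≢L b∈R′)) (R′-≢L a∈R′))
        ; acyclic      = λ { (cs , u , len , edge) → acyclic (cs , u , len , λ a b p → back (edge a b p)) }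
        }
        where
        tail : ∀ {a : Fin f} {l} → Unique (a ∷ l) → Unique l
        tail (_ ∷ u) = u
        Within-sym : ∀ {a b} → Within R (CoAdj F D) a b → Within R (CoAdj F D) b a
        Within-sym (a∈R , b∈R , c) = b∈R , a∈R , coAdj-sym PM D c
        Within-irrefl : ∀ {a} → ¬ Within R (CoAdj F D) a a
        Within-irrefl (_ , _ , c) = coAdj-≢ F D c refl
        back : ∀ {a b} → Within R′ (CoAdj F D′) a b → Within R (CoAdj F D) a b
        back (a∈R′ , b∈R′ , c) = R′⊆R a∈R′ , R′⊆R b∈R′ , D′⇒D a∈R′ b∈R′ c

    smaller : ∃₂ λ D′ R′ → IsCycle F D′ × TreeRegion D′ R′ × length R′ < length R × L′ ∈ R′ × (Contractible F D′ → Contractible F D)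
    smaller =
      let _ , e   = D-contains-path
          R′ , R↭ = ↭-remove L∈R
          open Shortcut e R↭
      in D′ , R′ , D′-cycle , region′ , ≤-reflexive (sym (↭-length R↭)) , L′∈R′ , contractible-back

  region-has-leaf : ∀ {D a b R} → TreeRegion D (a ∷ b ∷ R) → ∃₂ (IsLeaf (a ∷ b ∷ R) (CoAdj F D))
  region-has-leaf {D} {a} {b} {R} region with Star-first a≢b (connected a b (here refl) (there (here refl)))
    where
    open TreeRegion region
    a≢b : a ≢ b
    a≢b with faces-unique
    ... | (a≢b ∷ _) ∷ _ = a≢b
  ... | c , (a∈ , c∈ , a-c) =
    Leaves.leaf (CoAdj? F D) (coAdj-sym PM D) (λ c → coAdj-≢ F D c refl) (a ∷ b ∷ R) (TreeRegion.acyclic region) a∈ c∈ a-c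

  tree-region-contractible : ∀ k {D R a} → length R ≤ k → IsCycle F D → TreeRegion D R → a ∈ R → Contractible F D
  tree-region-contractible k       {R = []}        _         _     _      ()
  tree-region-contractible k       {R = L ∷ []}    _         cycle region _ = single-face-contractible cycle region
  tree-region-contractible zero    {R = _ ∷ _ ∷ _} ()
  tree-region-contractible (suc k) {D} {a ∷ b ∷ R} (s≤s len) cycle region _ =
    let L , L′ , L∈R , L′∈R , L-L′ , only-L′ = region-has-leaf region
        x , y , L-xy , L′-xy , xy∉D = coAdj-side F D L-L′
        D′ , R′ , cycle′ , region′ , shorter , L′∈R′ , back =
          LeafRemoval.smaller cycle region L∈R L′∈R (coAdj-≢ F D L-L′) only-L′ L-xy L′-xy xy∉D
    in back (tree-region-contractible k (≤-trans (≤-pred shorter) len) cycle′ region′ L′∈R′)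

module HamiltonianSeparator {n f : ℕ} {F : Fin f → List (Fin n)} (PM : PolyhedralMap F) {C : List (Fin n)}
                            (hamiltonian : HamiltonianCycle F C) (separating : Separating F C) where

  private
    C-unique : Unique C
    C-unique = proj₁ hamiltonian

    C-spans : length C ≡ n
    C-spans = proj₁ (proj₂ hamiltonian)

    C-length : 3 ≤ length C
    C-length = proj₁ (proj₂ (proj₂ hamiltonian))

    C-steps : ∀ u v → (u , v) ∈ cyc C → EdgeK F u v
    C-steps = proj₂ (proj₂ (proj₂ hamiltonian))

    C-edges : EdgesInEG F C
    C-edges u v adj with Adjacent⇒Side {l = C} adj
    ... | inj₁ uv∈C = C-steps u v uv∈C
    ... | inj₂ vu∈C = let i , s = C-steps v u vu∈C in i , swap s

  C-cycle : IsCycle F C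
  C-cycle = record { vertices-unique = C-unique ; length≥3 = C-length ; edges = C-edges }

  open Connectivity PM C C-cycle

  every-vertex-on-C : ∀ v → v ∈ C
  every-vertex-on-C = Unique-length≡⇒∈ C-unique C-spans

  faces-along-C : ∃₂ λ u v → Side C u v × ∃₂ λ A B → A ≢ B × Side (F A) u v × Side (F B) u v
  faces-along-C =
    let u , v , uv∈C = Adjacent-exists (≤-trans (n≤1+n 2) C-length)
        A , A-uv     = C-edges u v uv∈C
        B , B≢A , B-uv = opposite-face PM A-uv
    in u , v , Adjacent⇒Side uv∈C , A , B , ≢-sym B≢A , A-uv , B-uv

  ~-sym : ∀ {g h} → g ~ h → h ~ g
  ~-sym = Star.reverse (coAdj-sym PM C)

  sides-of-C-disconnected : ∀ {u v g h} → Side C u v → Side (F g) u v → Side (F h) u v → g ≢ h → ¬ g ~ h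
  sides-of-C-disconnected {g = g} uv∈C g-uv h-uv g≢h g~h =
    let a , b , a↮b = separating in a↮b (Star.map co⇒sep (to-g a ◅◅ ~-sym (to-g b)))
    where
    to-g : ∀ j → j ~ g
    to-g j = [ id , (_◅◅ ~-sym g~h) ] (faces-reach-side every-vertex-on-C uv∈C g-uv h-uv g≢h j)
    co⇒sep : ∀ {i j} → CoAdj F C i j → SepLink F C i j
    co⇒sep c with coAdj-side F C c
    ... | x , y , i-xy , j-xy , xy∉C = inj₁ (x , y , i-xy , j-xy , xy∉C)

  two-components : ∀ {u v g h} → Side C u v → Side (F g) u v → Side (F h) u v → g ≢ h → ∀ j → g ~ j ⊎ h ~ j
  two-components uv∈C g-uv h-uv g≢h j = ⊎-map ~-sym ~-sym (faces-reach-side every-vertex-on-C uv∈C g-uv h-uv g≢h j)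

  component-region : ∀ X vs → (∀ j → j ∈ vs → X ~ j) → (∀ j → X ~ j → j ∈ vs) → IsTreeIn F vs (CoAdj F C) →
                     TreeRegion PM C vs
  component-region X vs in-component component⊆ (unique , _ , _ , connected , acyclic) = record
    { faces-unique = unique
    ; boundary     = λ g∈ g-uv uv∈C h≢g h-uv h∈ →
                       sides-of-C-disconnected uv∈C g-uv h-uv (≢-sym h≢g) (~-sym (in-component _ g∈) ◅◅ in-component _ h∈)
    ; interior     = interior
    ; connected    = connected
    ; acyclic      = acyclic
    }
    where
    interior : ∀ {g h u v} → g ∈ vs → Side (F g) u v → ¬ Side C u v → Side (F h) u v → h ∈ vs
    interior {g} {h} g∈ g-uv uv∉C h-uv with h ≟ g
    ... | yes refl = g∈
    ... | no h≢g   = component⊆ h (in-component g g∈ ◅◅ coAdj PM C (≢-sym h≢g) g-uv h-uv uv∉C ◅ ε)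

  component-not-tree : ¬ Contractible F C → ∀ X vs → (∀ j → j ∈ vs → X ~ j) → (∀ j → X ~ j → j ∈ vs) →
                       ¬ ProperTree F vs (CoAdj F C)
  component-not-tree ¬contractible X vs in-component component⊆ (tree , _) =
    ¬contractible (tree-region-contractible PM _ ≤-refl C-cycle (component-region X vs in-component component⊆ tree) (component⊆ X ε))

lemma8 : {n f : ℕ} (F : Fin f → List (Fin n)) → PolyhedralMap F →
         (C : List (Fin n)) → HamiltonianCycle F C →
         Separating F C → ¬ Contractible F C →
         Σ (Fin f) λ a → Σ (Fin f) λ b →
           ¬ Star (CoAdj F C) a b ×
           (∀ j → Star (CoAdj F C) a j ⊎ Star (CoAdj F C) b j) ×
           (∀ vs → (∀ j → j ∈ vs → Star (CoAdj F C) a j) →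
                   (∀ j → Star (CoAdj F C) a j → j ∈ vs) →
                   ¬ ProperTree F vs (CoAdj F C)) ×
           (∀ vs → (∀ j → j ∈ vs → Star (CoAdj F C) b j) →
                   (∀ j → Star (CoAdj F C) b j → j ∈ vs) →
                   ¬ ProperTree F vs (CoAdj F C))
lemma8 F PM C hamiltonian separating ¬contractible =
  let open HamiltonianSeparator PM hamiltonian separating
      _ , _ , uv∈C , A , B , A≢B , A-uv , B-uv = faces-along-C
  in A , B , sides-of-C-disconnected uv∈C A-uv B-uv A≢B ,
     two-components uv∈C A-uv B-uv A≢B ,
     component-not-tree ¬contractible A ,
     component-not-tree ¬contractible B
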